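{- Let $n \geq 1$ and let $P$ be a regular polygon with $3n$ sides, one of which is marked. Then the number of triangulations of $P$ by non-intersecting diagonals that are $\mathbb{Z}_3$-symmetric (invariant under the rotations of $P$ by the angles $2\pi/3$ and $4\pi/3$ about its center) equals $n \cdot C_{n-1}$, where $C_j = \frac{1}{j+1}\binom{2j}{j}$ is the $j$-th Catalan number.
   Context: A triangulation of a convex polygon by non-intersecting diagonals is a maximal set of pairwise non-crossing diagonals, i.e. a subdivision of the polygon into triangles whose vertices are vertices of the polygon. Triangulations are counted as sets of diagonals of the fixed polygon $P$ (not up to rotation). -}

module Defs where

open import Data.Nat using (ℕ; zero; suc; _+_; _*_; _<_; _≤_; _/_)
open import Data.Nat.Combinatorics using (_C_)
open import Data.Fin using (Fin; toℕ)
open import Data.Fin.Subset using (Subset; _∈_)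
open import Data.Vec using (Vec; lookup)
open import Data.Product using (_×_; ∃; ∃-syntax)
open import Data.Sum using (_⊎_)
open import Data.List using (List; length)
open import Data.List.Relation.Unary.Unique.Propositional using (Unique)
import Data.List.Membership.Propositional as LM
open import Relation.Nullary using (¬_)
open import Relation.Binary.PropositionalEquality using (_≡_)
open import Function.Bundles using (_⇔_)

-- Catalan numbers  C_j = binom(2j, j) / (j + 1)  (exact division)
catalan : ℕ → ℕ
catalan j = ((2 * j) C j) / suc j

-- The convex polygon P with m vertices labelled 0, 1, ..., m-1 in cyclic
-- order (vertex i is adjacent to i+1 and to i-1 mod m).

-- A set of diagonals of P is recorded as an "adjacency table"
-- D : Vec (Subset m) m ; the pair {i , j} with i < j belongs to the set
-- iff  j ∈ lookup D i.  (Entries with i ≥ j are required to be empty by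
-- the definition of triangulation below.)
DiagSet : ℕ → Set
DiagSet m = Vec (Subset m) m

_∋⟨_,_⟩ : ∀ {m} → DiagSet m → Fin m → Fin m → Set
D ∋⟨ i , j ⟩ = j ∈ lookup D i

Has : ∀ {m} → DiagSet m → Fin m → Fin m → Set
Has D i j = D ∋⟨ i , j ⟩ ⊎ D ∋⟨ j , i ⟩

-- {i , j} with i < j is a diagonal of the m-gon: the two vertices are
-- distinct and not adjacent, i.e. j ≠ i + 1 and not (i = 0 and j = m - 1).
IsDiagonal : (m : ℕ) → Fin m → Fin m → Set
IsDiagonal m i j =
  (suc (toℕ i) < toℕ j) × ((0 < toℕ i) ⊎ (suc (toℕ j) < m))

Cross : ∀ {m} → Fin m → Fin m → Fin m → Fin m → Set
Cross i j k l =
    (toℕ i < toℕ k × toℕ k < toℕ j × toℕ j < toℕ l)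
  ⊎ (toℕ k < toℕ i × toℕ i < toℕ l × toℕ l < toℕ j)

IsTriangulation : (m : ℕ) → DiagSet m → Set
IsTriangulation m D =
    (∀ i j → D ∋⟨ i , j ⟩ → IsDiagonal m i j)
  × (∀ i j k l → D ∋⟨ i , j ⟩ → D ∋⟨ k , l ⟩ → ¬ Cross i j k l)
  × (∀ i j → IsDiagonal m i j → ¬ (D ∋⟨ i , j ⟩) →
       ∃[ k ] ∃[ l ] (D ∋⟨ k , l ⟩ × Cross i j k l))

-- vertex a is sent to vertex b by the rotation of the m-gon by s steps
-- (b ≡ a + s mod m, for s < m)
RotatesTo : (m s : ℕ) → {m' : ℕ} → Fin m' → Fin m' → Set
RotatesTo m s a b = (toℕ a + s ≡ toℕ b) ⊎ (toℕ a + s ≡ toℕ b + m)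

InvariantUnderRotation : (m s : ℕ) → DiagSet m → Set
InvariantUnderRotation m s D =
  ∀ i j i' j' → RotatesTo m s i i' → RotatesTo m s j j' →
    (Has D i j ⇔ Has D i' j')

-- P has 3n vertices; the rotations by 2π/3 and 4π/3 shift vertices
-- by n and 2n steps respectively.
IsZ3SymmetricTriangulation : (n : ℕ) → DiagSet (3 * n) → Set
IsZ3SymmetricTriangulation n D =
    IsTriangulation (3 * n) D
  × InvariantUnderRotation (3 * n) n D
  × InvariantUnderRotation (3 * n) (2 * n) D

-- "the finite type of objects satisfying P has exactly k elements":
-- a duplicate-free list enumerating exactly the objects satisfying P.
HasCardinality : ∀ {A : Set} → (A → Set) → ℕ → Set
HasCardinality {A} P k =
  ∃[ L ] (Unique {A = A} L × (∀ x → (x LM.∈ L) ⇔ P x) × length L ≡ k)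

module Submission where

-- A triangulation invariant under the rotation by n steps contains a central triangle
-- (a , a + n , a + 2n) with a < n: descending from a long edge through the triangles of
-- the subdivision, one reaches a triangle with no side of length strictly between n
-- and 2n, which a side and its rotated copy would otherwise cross.  The three sides of
-- the central triangle cut off three arcs, each triangulated by a rotated copy of the
-- same triangulation of an (n + 1)-gon, i.e. of a binary tree with n - 1 internal nodes.
-- Conversely, for every a < n and every such tree the three copies together with the
-- central triangle form a symmetric triangulation, and the pair (a , tree) can be read
-- back from it.  Hence the symmetric triangulations are in bijection with pairs
-- (a , t), a < n, t a binary tree of size n - 1, of which there are n · C (n - 1).

open import Defs
open import Data.Nat
open import Data.Nat.Properties
open import Data.Nat.Induction using (<-rec)
open import Data.Nat.DivMod using (_/_; _%_; /-congˡ; m*n/n≡m; m%n<n; m<n⇒m%n≡m; [m+n]%n≡m%n; %-distribˡ-+; m%n%n≡m%n; n%n≡0)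
open import Data.Nat.Combinatorics using (_C_; nCk≡n!/k![n-k]!)
open import Data.Nat.Tactic.RingSolver using (solve-∀)
open import Data.Bool using (true)
open import Data.Fin using (Fin; toℕ; fromℕ<)
open import Data.Fin.Properties using (toℕ-injective; toℕ<n; toℕ-fromℕ<; fromℕ<-toℕ)
open import Data.Fin.Subset.Properties using (_∈?_; ⊆-antisym)
open import Data.Vec using (lookup; tabulate)
open import Data.Vec.Properties using (lookup∘tabulate; tabulate∘lookup; tabulate-cong; []=⇒lookup; lookup⇒[]=)
open import Data.List using (List; []; _∷_; _++_; map; length; cartesianProductWith; cartesianProduct; upTo)
open import Data.List.Properties using (length-map; length-++; length-upTo)
open import Data.List.Membership.Propositional using (_∈_)
open import Data.List.Membership.Propositional.Properties
  using (∈-++⁺ˡ; ∈-++⁺ʳ; ∈-++⁻; ∈-cartesianProductWith⁺; ∈-cartesianProductWith⁻; ∈-map⁻; ∈-map⁺; ∈-cartesianProduct⁻; ∈-cartesianProduct⁺; ∈-upTo⁺; ∈-upTo⁻)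
open import Data.List.Relation.Unary.Any using (here; there)
import Data.List.Relation.Unary.All as All
open import Data.List.Relation.Unary.AllPairs using ([]; _∷_)
open import Data.List.Relation.Unary.Unique.Propositional using (Unique)
open import Data.List.Relation.Unary.Unique.Propositional.Properties using (++⁺; cartesianProductWith⁺; cartesianProduct⁺; upTo⁺)
open import Data.List.Relation.Binary.Disjoint.Propositional using (Disjoint)
open import Data.Product using (∃; ∃₂; ∃-syntax; _×_; _,_; proj₁; proj₂)
open import Data.Sum using (_⊎_; inj₁; inj₂)
open import Data.Empty using (⊥; ⊥-elim)
open import Relation.Nullary using (¬_; Dec; yes; no; does)
open import Relation.Nullary.Decidable using (_×-dec_; _⊎-dec_)
open import Relation.Binary.PropositionalEquality
open import Relation.Binary.Definitions using (tri<; tri≈; tri>) renaming (Tri to Trichotomy)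
open import Function.Bundles using (_⇔_; mk⇔; module Equivalence)
open import Function.Construct.Symmetry using (⇔-sym)
open import Function.Construct.Composition using (_⇔-∘_)
open Equivalence using (to; from)

data Tree : Set where
  leaf : Tree
  node : Tree → Tree → Tree

size : Tree → ℕ
size leaf = 0
size (node l r) = suc (size l + size r)

node-injective : ∀ {l r l' r'} → node l r ≡ node l' r' → l ≡ l' × r ≡ r'
node-injective refl = refl , refl

sumBelow : ℕ → (ℕ → ℕ) → ℕ
sumBelow zero f = 0
sumBelow (suc n) f = sumBelow n f + f n

joins : List Tree → List Tree → List Tree
joins = cartesianProductWith node

-- Given lists `g j` of the trees of size j (j ≤ k), `splits g k i` lists the
-- trees of size k + 1 whose left subtree has size < i.
splits : (ℕ → List Tree) → ℕ → ℕ → List Tree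
splits g k zero = []
splits g k (suc i) = splits g k i ++ joins (g i) (g (k ∸ i))

-- `enum f k` lists the trees of size k, by a recursion of depth f ≥ k.
enum : ℕ → ℕ → List Tree
enum f zero = leaf ∷ []
enum zero (suc k) = []
enum (suc f) (suc k) = splits (enum f) k (suc k)

trees : ℕ → List Tree
trees k = enum k k

enum-stable : ∀ f g k → k ≤ f → k ≤ g → enum f k ≡ enum g k
enum-stable f g zero _ _ = refl
enum-stable (suc f) (suc g) (suc k) (s≤s k≤f) (s≤s k≤g) = splits-cong (suc k) ≤-refl
  where
  splits-cong : ∀ i → i ≤ suc k → splits (enum f) k i ≡ splits (enum g) k i
  splits-cong zero _ = refl
  splits-cong (suc i) (s≤s i≤k) =
    cong₂ _++_ (splits-cong i (m≤n⇒m≤1+n i≤k))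
               (cong₂ joins (same i i≤k) (same (k ∸ i) (m∸n≤m k i)))
    where
    same : ∀ j → j ≤ k → enum f j ≡ enum g j
    same j j≤k = enum-stable f g j (≤-trans j≤k k≤f) (≤-trans j≤k k≤g)

enum-sound : ∀ f k t → t ∈ enum f k → size t ≡ k
enum-sound f zero t (here refl) = refl
enum-sound zero (suc k) t ()
enum-sound (suc f) (suc k) t = splits-sound (suc k) ≤-refl
  where
  splits-sound : ∀ i → i ≤ suc k → t ∈ splits (enum f) k i → size t ≡ suc k
  splits-sound (suc i) (s≤s i≤k) t∈ with ∈-++⁻ (splits (enum f) k i) t∈
  ... | inj₁ t∈' = splits-sound i (m≤n⇒m≤1+n i≤k) t∈'
  ... | inj₂ t∈' with ∈-cartesianProductWith⁻ node (enum f i) (enum f (k ∸ i)) t∈'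
  ...   | l , r , l∈ , r∈ , refl =
          cong suc (trans (cong₂ _+_ (enum-sound f i l l∈) (enum-sound f (k ∸ i) r r∈)) (m+[n∸m]≡n i≤k))

enum-complete : ∀ f k t → size t ≡ k → k ≤ f → t ∈ enum f k
enum-complete f zero leaf refl _ = here refl
enum-complete (suc f) (suc k) (node l r) size≡ (s≤s k≤f) =
  splits-complete (suc k) (s≤s |l|≤k)
  where
  sizes : size l + size r ≡ k
  sizes = suc-injective size≡
  |l|≤k : size l ≤ k
  |l|≤k = subst (size l ≤_) sizes (m≤m+n (size l) (size r))
  |r|≡ : size r ≡ k ∸ size l
  |r|≡ = sym (trans (cong (_∸ size l) (sym sizes)) (m+n∸m≡n (size l) (size r)))
  node∈joins : node l r ∈ joins (enum f (size l)) (enum f (k ∸ size l))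
  node∈joins = ∈-cartesianProductWith⁺ node
    (enum-complete f (size l) l refl (≤-trans |l|≤k k≤f))
    (enum-complete f (k ∸ size l) r |r|≡ (≤-trans (m∸n≤m k (size l)) k≤f))
  splits-complete : ∀ i → size l < i → node l r ∈ splits (enum f) k i
  splits-complete (suc i) |l|<1+i with size l ≟ i
  ... | yes refl = ∈-++⁺ʳ (splits (enum f) k (size l)) node∈joins
  ... | no |l|≢i = ∈-++⁺ˡ (splits-complete i (≤∧≢⇒< (≤-pred |l|<1+i) |l|≢i))

trees-mem : ∀ k t → (t ∈ trees k) ⇔ (size t ≡ k)
trees-mem k t = mk⇔ (enum-sound k k t) (λ e → enum-complete k k t e ≤-refl)

-- The enumeration has no repetitions: distinct blocks of `splits` have
-- left subtrees of distinct sizes.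
enum-unique : ∀ f k → Unique (enum f k)
enum-unique f zero = All.[] ∷ []
enum-unique zero (suc k) = []
enum-unique (suc f) (suc k) = splits-unique (suc k)
  where
  joins-unique : ∀ i j → Unique (joins (enum f i) (enum f j))
  joins-unique i j = cartesianProductWith⁺ node node-injective (enum-unique f i) (enum-unique f j)
  left-small : ∀ i t → t ∈ splits (enum f) k i → ∃₂ λ l r → t ≡ node l r × size l < i
  left-small (suc i) t t∈ with ∈-++⁻ (splits (enum f) k i) t∈
  ... | inj₁ t∈' with left-small i t t∈'
  ...   | l , r , refl , |l|<i = l , r , refl , m<n⇒m<1+n |l|<i
  left-small (suc i) t t∈ | inj₂ t∈' with ∈-cartesianProductWith⁻ node (enum f i) (enum f (k ∸ i)) t∈'
  ...   | l , r , l∈ , _ , refl = l , r , refl , s≤s (≤-reflexive (enum-sound f i l l∈))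
  splits-unique : ∀ i → Unique (splits (enum f) k i)
  splits-unique zero = []
  splits-unique (suc i) = ++⁺ (splits-unique i) (joins-unique i (k ∸ i)) disjoint
    where
    disjoint : Disjoint (splits (enum f) k i) (joins (enum f i) (enum f (k ∸ i)))
    disjoint (t∈ , t∈') with left-small i _ t∈ | ∈-cartesianProductWith⁻ node (enum f i) (enum f (k ∸ i)) t∈'
    ... | l , r , refl , |l|<i | l' , r' , l'∈ , _ , e with node-injective e
    ...   | refl , refl = <-irrefl (enum-sound f i l l'∈) |l|<i

trees-unique : ∀ k → Unique (trees k)
trees-unique k = enum-unique k k

treeCount : ℕ → ℕ
treeCount k = length (trees k)

sumBelow-cong : ∀ n f g → (∀ j → j < n → f j ≡ g j) → sumBelow n f ≡ sumBelow n g
sumBelow-cong zero f g _ = refl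
sumBelow-cong (suc n) f g f≗g =
  cong₂ _+_ (sumBelow-cong n f g (λ j j<n → f≗g j (m<n⇒m<1+n j<n))) (f≗g n ≤-refl)

sumBelow-+ : ∀ n f g → sumBelow n (λ j → f j + g j) ≡ sumBelow n f + sumBelow n g
sumBelow-+ zero f g = refl
sumBelow-+ (suc n) f g =
  trans (cong (_+ (f n + g n)) (sumBelow-+ n f g)) (swap (sumBelow n f) (sumBelow n g) (f n) (g n))
  where
  swap : ∀ a b c d → a + b + (c + d) ≡ a + c + (b + d)
  swap = solve-∀

sumBelow-* : ∀ n c f → sumBelow n (λ j → c * f j) ≡ c * sumBelow n f
sumBelow-* zero c f = sym (*-zeroʳ c)
sumBelow-* (suc n) c f =
  trans (cong (_+ c * f n) (sumBelow-* n c f)) (sym (*-distribˡ-+ c (sumBelow n f) (f n)))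

sumBelow-shift : ∀ n f → sumBelow (suc n) f ≡ f 0 + sumBelow n (λ j → f (suc j))
sumBelow-shift zero f = +-comm 0 (f 0)
sumBelow-shift (suc n) f = trans (cong (_+ f (suc n)) (sumBelow-shift n f)) (+-assoc (f 0) _ _)

sumBelow-reverse : ∀ n f → sumBelow n f ≡ sumBelow n (λ j → f (n ∸ suc j))
sumBelow-reverse zero f = refl
sumBelow-reverse (suc n) f =
  trans (cong (_+ f n) (sumBelow-reverse n f))
        (trans (+-comm _ (f n)) (sym (sumBelow-shift n (λ j → f (suc n ∸ suc j)))))

length-joins : ∀ L R → length (joins L R) ≡ length L * length R
length-joins [] R = refl
length-joins (l ∷ L) R =
  trans (length-++ (map (node l) R)) (cong₂ _+_ (length-map (node l) R) (length-joins L R))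

length-splits : ∀ g k i → length (splits g k i) ≡ sumBelow i (λ j → length (g j) * length (g (k ∸ j)))
length-splits g k zero = refl
length-splits g k (suc i) =
  trans (length-++ (splits g k i)) (cong₂ _+_ (length-splits g k i) (length-joins (g i) (g (k ∸ i))))

segnerTerm : ℕ → ℕ → ℕ
segnerTerm k j = treeCount j * treeCount (k ∸ j)

segner : ∀ k → sumBelow (suc k) (segnerTerm k) ≡ treeCount (suc k)
segner k = sym (trans (length-splits (enum k) k (suc k)) (sumBelow-cong (suc k) _ _ same))
  where
  same : ∀ j → j < suc k → length (enum k j) * length (enum k (k ∸ j)) ≡ segnerTerm k j
  same j j<1+k = cong₂ _*_ (cong length (enum-stable k j j (≤-pred j<1+k) ≤-refl))
                           (cong length (enum-stable k (k ∸ j) (k ∸ j) (m∸n≤m k j) ≤-refl))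

weighted : ℕ → (ℕ → ℕ) → ℕ
weighted k w = sumBelow (suc k) (λ j → w j * segnerTerm k j)

weighted-reverse : ∀ k w → weighted k w ≡ weighted k (λ j → w (k ∸ j))
weighted-reverse k w = trans (sumBelow-reverse (suc k) _) (sumBelow-cong (suc k) _ _ symmetric)
  where
  symmetric : ∀ j → j < suc k → w (k ∸ j) * segnerTerm k (k ∸ j) ≡ w (k ∸ j) * segnerTerm k j
  symmetric j j<1+k = cong (w (k ∸ j) *_)
    (trans (cong (λ x → treeCount (k ∸ j) * treeCount x) (m∸[m∸n]≡n (≤-pred j<1+k)))
           (*-comm (treeCount (k ∸ j)) (treeCount j)))

weighted-pair : ∀ k w v c → (∀ j → j ≤ k → w j + v j ≡ c) →
                weighted k w + weighted k v ≡ c * treeCount (suc k)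
weighted-pair k w v c w+v≡c = begin
  weighted k w + weighted k v
    ≡⟨ sumBelow-+ (suc k) _ _ ⟨
  sumBelow (suc k) (λ j → w j * segnerTerm k j + v j * segnerTerm k j)
    ≡⟨ sumBelow-cong (suc k) _ _ (λ j j<1+k →
         trans (sym (*-distribʳ-+ (segnerTerm k j) (w j) (v j)))
               (cong (_* segnerTerm k j) (w+v≡c j (≤-pred j<1+k)))) ⟩
  sumBelow (suc k) (λ j → c * segnerTerm k j)
    ≡⟨ sumBelow-* (suc k) c (segnerTerm k) ⟩
  c * sumBelow (suc k) (segnerTerm k)
    ≡⟨ cong (c *_) (segner k) ⟩
  c * treeCount (suc k) ∎
  where open ≡-Reasoning

first-moment : ∀ k → 2 * weighted k (λ j → j) ≡ k * treeCount (suc k)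
first-moment k = trans (double (weighted k (λ j → j)))
  (trans (cong (weighted k (λ j → j) +_) (weighted-reverse k (λ j → j)))
         (weighted-pair k (λ j → j) (k ∸_) k (λ _ → m+[n∸m]≡n)))
  where
  double : ∀ x → 2 * x ≡ x + x
  double = solve-∀

shifted-moment : ∀ k → 2 * weighted k suc ≡ suc (suc k) * treeCount (suc k)
shifted-moment k = trans (double (weighted k suc))
  (trans (cong (weighted k suc +_) (weighted-reverse k suc))
         (weighted-pair k suc (λ j → suc (k ∸ j)) (suc (suc k)) sum≡))
  where
  double : ∀ x → 2 * x ≡ x + x
  double = solve-∀
  sum≡ : ∀ j → j ≤ k → suc j + suc (k ∸ j) ≡ suc (suc k)
  sum≡ j j≤k = trans (+-suc (suc j) (k ∸ j)) (cong (λ x → suc (suc x)) (m+[n∸m]≡n j≤k))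

Ballot : ℕ → Set
Ballot k = suc (suc k) * treeCount (suc k) ≡ 2 * suc (2 * k) * treeCount k

shifted-moment-suc : ∀ k → (∀ {j} → j < suc k → Ballot j) →
                     weighted (suc k) suc ≡ suc (2 * suc k) * treeCount (suc k)
shifted-moment-suc k ballot< = begin
  weighted (suc k) suc
    ≡⟨ sumBelow-shift (suc k) _ ⟩
  1 * segnerTerm (suc k) 0 + sumBelow (suc k) (λ j → suc (suc j) * segnerTerm (suc k) (suc j))
    ≡⟨ cong₂ _+_ (trans (*-identityˡ _) (*-identityˡ T)) (sumBelow-cong (suc k) _ _ (λ j j<1+k → term j (ballot< j<1+k))) ⟩
  T + sumBelow (suc k) (λ j → 4 * (j * segnerTerm k j) + 2 * segnerTerm k j)
    ≡⟨ cong (T +_) (sumBelow-+ (suc k) _ _) ⟩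
  T + (sumBelow (suc k) (λ j → 4 * (j * segnerTerm k j)) + sumBelow (suc k) (λ j → 2 * segnerTerm k j))
    ≡⟨ cong₂ (λ x y → T + (x + y)) (sumBelow-* (suc k) 4 _) (sumBelow-* (suc k) 2 _) ⟩
  T + (4 * weighted k (λ j → j) + 2 * sumBelow (suc k) (segnerTerm k))
    ≡⟨ cong₂ (λ x y → T + (x + 2 * y)) (trans (four (weighted k (λ j → j))) (cong (2 *_) (first-moment k))) (segner k) ⟩
  T + (2 * (k * T) + 2 * T)
    ≡⟨ collect k T ⟩
  suc (2 * suc k) * T ∎
  where
  open ≡-Reasoning
  T = treeCount (suc k)
  four : ∀ x → 4 * x ≡ 2 * (2 * x)
  four = solve-∀
  collect : ∀ k s → s + (2 * (k * s) + 2 * s) ≡ suc (2 * suc k) * s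
  collect = solve-∀
  term : ∀ j → Ballot j → suc (suc j) * segnerTerm (suc k) (suc j) ≡ 4 * (j * segnerTerm k j) + 2 * segnerTerm k j
  term j ballot = begin
    suc (suc j) * (treeCount (suc j) * treeCount (k ∸ j))
      ≡⟨ *-assoc (suc (suc j)) (treeCount (suc j)) (treeCount (k ∸ j)) ⟨
    suc (suc j) * treeCount (suc j) * treeCount (k ∸ j)
      ≡⟨ cong (_* treeCount (k ∸ j)) ballot ⟩
    2 * suc (2 * j) * treeCount j * treeCount (k ∸ j)
      ≡⟨ expand j (treeCount j) (treeCount (k ∸ j)) ⟩
    4 * (j * segnerTerm k j) + 2 * segnerTerm k j ∎
    where
    expand : ∀ j a b → 2 * suc (2 * j) * a * b ≡ 4 * (j * (a * b)) + 2 * (a * b)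
    expand = solve-∀

-- the recurrence, by strong induction: compute 2 Σ (j+1) T j T (k+1-j) in two ways
ballot : ∀ k → Ballot k
ballot = <-rec Ballot step
  where
  step : ∀ k → (∀ {j} → j < k → Ballot j) → Ballot k
  step zero _ = refl
  step (suc k) ballot< = begin
    suc (suc (suc k)) * treeCount (suc (suc k)) ≡⟨ shifted-moment (suc k) ⟨
    2 * weighted (suc k) suc                    ≡⟨ cong (2 *_) (shifted-moment-suc k ballot<) ⟩
    2 * (suc (2 * suc k) * treeCount (suc k))   ≡⟨ *-assoc 2 (suc (2 * suc k)) (treeCount (suc k)) ⟨
    2 * suc (2 * suc k) * treeCount (suc k)     ∎
    where open ≡-Reasoning

treeCount-factorials : ∀ k → treeCount k * (k ! * (suc k) !) ≡ (2 * k) !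
treeCount-factorials zero = refl
treeCount-factorials (suc k) = begin
  treeCount (suc k) * ((suc k) ! * (suc (suc k)) !)
    ≡⟨ regroup k (treeCount (suc k)) (k !) ⟩
  (suc (suc k) * treeCount (suc k)) * ((suc k * k !) * (suc k * k !))
    ≡⟨ cong (_* ((suc k * k !) * (suc k * k !))) (ballot k) ⟩
  (2 * suc (2 * k) * treeCount k) * ((suc k * k !) * (suc k * k !))
    ≡⟨ regroup' k (treeCount k) (k !) ⟩
  suc (suc (2 * k)) * (suc (2 * k) * (treeCount k * (k ! * (suc k) !)))
    ≡⟨ cong (λ x → suc (suc (2 * k)) * (suc (2 * k) * x)) (treeCount-factorials k) ⟩
  (suc (suc (2 * k))) !
    ≡⟨ cong _! (double-suc k) ⟩
  (2 * suc k) ! ∎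
  where
  open ≡-Reasoning
  regroup : ∀ k s f → s * ((suc k * f) * (suc (suc k) * (suc k * f))) ≡ (suc (suc k) * s) * ((suc k * f) * (suc k * f))
  regroup = solve-∀
  regroup' : ∀ k s f → 2 * suc (2 * k) * s * ((suc k * f) * (suc k * f)) ≡ suc (suc (2 * k)) * (suc (2 * k) * (s * (f * (suc k * f))))
  regroup' = solve-∀
  double-suc : ∀ k → suc (suc (2 * k)) ≡ 2 * suc k
  double-suc = solve-∀

central-binomial : ∀ k → (2 * k) C k ≡ treeCount k * suc k
central-binomial k = trans (nCk≡n!/k![n-k]! k≤2k) (quotient (2 * k ∸ k) 2k∸k≡k)
  where
  k≤2k : k ≤ 2 * k
  k≤2k = subst (k ≤_) (sym (cong (k +_) (+-identityʳ k))) (m≤m+n k k)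
  2k∸k≡k : 2 * k ∸ k ≡ k
  2k∸k≡k = trans (cong (λ x → k + x ∸ k) (+-identityʳ k)) (m+n∸m≡n k k)
  quotient : ∀ j → j ≡ k → ((2 * k) ! / (k ! * j !)) {{k !* j !≢0}} ≡ treeCount k * suc k
  quotient j refl =
    trans (/-congˡ {{k !* k !≢0}} factorials) (m*n/n≡m (treeCount k * suc k) (k ! * k !) {{k !* k !≢0}})
    where
    factorials : (2 * k) ! ≡ treeCount k * suc k * (k ! * k !)
    factorials = trans (sym (treeCount-factorials k)) (regroup (treeCount k) k (k !))
      where
      regroup : ∀ s k f → s * (f * (suc k * f)) ≡ s * suc k * (f * f)
      regroup = solve-∀

catalan≡treeCount : ∀ k → catalan k ≡ treeCount k
catalan≡treeCount k = trans (/-congˡ (central-binomial k)) (m*n/n≡m (treeCount k) (suc k))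

width : Tree → ℕ
width leaf = 1
width (node l r) = width l + width r

width-pos : ∀ t → 1 ≤ width t
width-pos leaf = s≤s z≤n
width-pos (node l r) = ≤-trans (width-pos l) (m≤m+n (width l) (width r))

width≡1+size : ∀ t → width t ≡ suc (size t)
width≡1+size leaf = refl
width≡1+size (node l r) = trans (cong₂ _+_ (width≡1+size l) (width≡1+size r)) (cong suc (+-suc (size l) (size r)))

Crosses : ℕ → ℕ → ℕ → ℕ → Set
Crosses i j k l = (i < k × k < j × j < l) ⊎ (k < i × i < l × l < j)

crosses-sym : ∀ {i j k l} → Crosses i j k l → Crosses k l i j
crosses-sym (inj₁ c) = inj₂ c
crosses-sym (inj₂ c) = inj₁ c

no-cross-outer : ∀ {x b i j} → x ≤ i → j ≤ b → ¬ Crosses x b i j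
no-cross-outer x≤i j≤b (inj₁ (_ , _ , b<j)) = <⇒≱ b<j j≤b
no-cross-outer x≤i j≤b (inj₂ (i<x , _)) = <⇒≱ i<x x≤i

no-cross-separated : ∀ {i j k l} c → j ≤ c → c ≤ k → ¬ Crosses i j k l
no-cross-separated c j≤c c≤k (inj₁ (_ , k<j , _)) = <⇒≱ k<j (≤-trans j≤c c≤k)
no-cross-separated c j≤c c≤k (inj₂ (k<i , i<l , l<j)) = <⇒≱ (<-trans k<i (<-trans i<l l<j)) (≤-trans j≤c c≤k)

-- These are the
-- sides and the diagonals of a triangulation of the polygon with vertices
-- x , x + 1 , ... , x + width t (the standard bijection of trees and triangulations).
Chord : Tree → ℕ → ℕ → ℕ → Set
InnerChord : Tree → ℕ → ℕ → ℕ → Set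
Chord t x i j = (i ≡ x × j ≡ x + width t) ⊎ InnerChord t x i j
InnerChord leaf x i j = ⊥
InnerChord (node l r) x i j = Chord l x i j ⊎ Chord r (x + width l) i j

chord? : ∀ t x i j → Dec (Chord t x i j)
inner? : ∀ t x i j → Dec (InnerChord t x i j)
chord? t x i j = ((i ≟ x) ×-dec (j ≟ x + width t)) ⊎-dec inner? t x i j
inner? leaf x i j = no (λ ())
inner? (node l r) x i j = chord? l x i j ⊎-dec chord? r (x + width l) i j

right-end : ∀ x l r → x + width l + width r ≡ x + width (node l r)
right-end x l r = +-assoc x (width l) (width r)

chord-bounds : ∀ {t x i j} → Chord t x i j → x ≤ i × i < j × j ≤ x + width t
chord-bounds {t} {x} (inj₁ (refl , refl)) = ≤-refl , m<m+n x (width-pos t) , ≤-refl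
chord-bounds {node l r} {x} (inj₂ (inj₁ c)) with chord-bounds c
... | x≤i , i<j , j≤ = x≤i , i<j , ≤-trans j≤ (≤-trans (m≤m+n (x + width l) (width r)) (≤-reflexive (right-end x l r)))
chord-bounds {node l r} {x} (inj₂ (inj₂ c)) with chord-bounds c
... | x≤i , i<j , j≤ = ≤-trans (m≤m+n x (width l)) x≤i , i<j , ≤-trans j≤ (≤-reflexive (right-end x l r))

chords-noncrossing : ∀ t x {i j k l} → Chord t x i j → Chord t x k l → ¬ Crosses i j k l
chords-noncrossing t x (inj₁ (refl , refl)) c' with chord-bounds c'
... | x≤k , _ , l≤ = no-cross-outer x≤k l≤
chords-noncrossing t x (inj₂ c) (inj₁ (refl , refl)) cr with chord-bounds {t} (inj₂ c)
... | x≤i , _ , j≤ = no-cross-outer x≤i j≤ (crosses-sym cr)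
chords-noncrossing (node l r) x (inj₂ (inj₁ c)) (inj₂ (inj₁ c')) = chords-noncrossing l x c c'
chords-noncrossing (node l r) x (inj₂ (inj₂ c)) (inj₂ (inj₂ c')) = chords-noncrossing r (x + width l) c c'
chords-noncrossing (node l r) x (inj₂ (inj₁ c)) (inj₂ (inj₂ c')) =
  no-cross-separated (x + width l) (proj₂ (proj₂ (chord-bounds c))) (proj₁ (chord-bounds c'))
chords-noncrossing (node l r) x (inj₂ (inj₂ c)) (inj₂ (inj₁ c')) cr =
  no-cross-separated (x + width l) (proj₂ (proj₂ (chord-bounds c'))) (proj₁ (chord-bounds c)) (crosses-sym cr)

-- Inside the left or right part we recurse; a segment straddling the split point
-- x + width l crosses the chord of the left part (if it starts after x) or the chord
-- of the right part (if it starts at x).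
chords-maximal : ∀ t x i j → x ≤ i → i < j → j ≤ x + width t → ¬ Chord t x i j →
                 ∃₂ λ k l → Chord t x k l × Crosses i j k l
chords-maximal leaf x i j x≤i i<j j≤ ¬c = ⊥-elim (¬c (inj₁ (i≡x , j≡)))
  where
  i≡x : i ≡ x
  i≡x = ≤-antisym (≤-pred (≤-trans i<j (subst (j ≤_) (+-comm x 1) j≤))) x≤i
  j≡ : j ≡ x + 1
  j≡ = ≤-antisym j≤ (subst (_≤ j) (trans (cong suc i≡x) (+-comm 1 x)) i<j)
chords-maximal (node l r) x i j x≤i i<j j≤ ¬c with j ≤? x + width l | x + width l ≤? i
... | yes j≤mid | _ with chords-maximal l x i j x≤i i<j j≤mid (λ c → ¬c (inj₂ (inj₁ c)))
...   | k , k' , c , cr = k , k' , inj₂ (inj₁ c) , cr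
chords-maximal (node l r) x i j x≤i i<j j≤ ¬c | no _ | yes mid≤i
  with chords-maximal r (x + width l) i j mid≤i i<j (subst (j ≤_) (sym (right-end x l r)) j≤) (λ c → ¬c (inj₂ (inj₂ c)))
... | k , k' , c , cr = k , k' , inj₂ (inj₂ c) , cr
chords-maximal (node l r) x i j x≤i i<j j≤ ¬c | no mid<j | no i<mid with i ≟ x
... | yes refl = x + width l , x + width l + width r , inj₂ (inj₂ (inj₁ (refl , refl))) ,
                 inj₁ (m<m+n x (width-pos l) , ≰⇒> mid<j , j<end)
  where
  j<end : j < x + width l + width r
  j<end = ≤∧≢⇒< (subst (j ≤_) (sym (right-end x l r)) j≤)
                (λ j≡ → ¬c (inj₁ (refl , trans j≡ (right-end x l r))))
... | no i≢x = x , x + width l , inj₂ (inj₁ (inj₁ (refl , refl))) ,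
               inj₂ (≤∧≢⇒< x≤i (λ e → i≢x (sym e)) , ≰⇒> i<mid , ≰⇒> mid<j)

chord-shift : ∀ t x s {i j} → Chord t x i j → Chord t (s + x) (s + i) (s + j)
chord-shift t x s (inj₁ (refl , refl)) = inj₁ (refl , sym (+-assoc s x (width t)))
chord-shift (node l r) x s (inj₂ (inj₁ c)) = inj₂ (inj₁ (chord-shift l x s c))
chord-shift (node l r) x s {i} {j} (inj₂ (inj₂ c)) =
  inj₂ (inj₂ (subst (λ z → Chord r z (s + i) (s + j)) (sym (+-assoc s x (width l))) (chord-shift r (x + width l) s c)))

chord-unshift : ∀ t x s {i j} → Chord t (s + x) (s + i) (s + j) → Chord t x i j
chord-unshift t x s {i} {j} (inj₁ (e , e')) =
  inj₁ (+-cancelˡ-≡ s i x e , +-cancelˡ-≡ s j (x + width t) (trans e' (+-assoc s x (width t))))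
chord-unshift (node l r) x s (inj₂ (inj₁ c)) = inj₂ (inj₁ (chord-unshift l x s c))
chord-unshift (node l r) x s {i} {j} (inj₂ (inj₂ c)) =
  inj₂ (inj₂ (chord-unshift r (x + width l) s (subst (λ z → Chord r z (s + i) (s + j)) (+-assoc s x (width l)) c)))

chord-left : ∀ l r x {i j} → Chord (node l r) x i j → j ≤ x + width l → Chord l x i j
chord-left l r x (inj₁ (refl , refl)) j≤ =
  ⊥-elim (<⇒≱ (subst (x + width l <_) (right-end x l r) (m<m+n (x + width l) (width-pos r))) j≤)
chord-left l r x (inj₂ (inj₁ c)) j≤ = c
chord-left l r x (inj₂ (inj₂ c)) j≤ with chord-bounds c
... | mid≤i , i<j , _ = ⊥-elim (<⇒≱ i<j (≤-trans j≤ mid≤i))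

chord-right : ∀ l r x {i j} → Chord (node l r) x i j → x + width l ≤ i → Chord r (x + width l) i j
chord-right l r x (inj₁ (refl , refl)) mid≤i = ⊥-elim (<⇒≱ (m<m+n x (width-pos l)) mid≤i)
chord-right l r x (inj₂ (inj₁ c)) mid≤i with chord-bounds c
... | _ , i<j , j≤ = ⊥-elim (<⇒≱ i<j (≤-trans j≤ mid≤i))
chord-right l r x (inj₂ (inj₂ c)) mid≤i = c

_⊆ᶜ_ : (ℕ → ℕ → Set) → (ℕ → ℕ → Set) → Set
P ⊆ᶜ Q = ∀ {i j} → P i j → Q i j

-- Trees placed at the same point with the same chords are equal: the root chord
-- fixes the width and the chord (x , x + width l) fixes the split point.
chords-determine-tree : ∀ t t' x → Chord t x ⊆ᶜ Chord t' x → Chord t' x ⊆ᶜ Chord t x → t ≡ t'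
chords-determine-tree t t' x t⊆t' t'⊆t with widths-equal
  where
  widths-equal : width t ≡ width t'
  widths-equal = +-cancelˡ-≡ x _ _ (≤-antisym (proj₂ (proj₂ (chord-bounds (t⊆t' (inj₁ (refl , refl))))))
                                              (proj₂ (proj₂ (chord-bounds (t'⊆t (inj₁ (refl , refl)))))))
chords-determine-tree leaf leaf x _ _ | _ = refl
chords-determine-tree leaf (node l r) x _ _ | 1≡ = ⊥-elim (<⇒≱ (+-mono-≤ (width-pos l) (width-pos r)) (≤-reflexive (sym 1≡)))
chords-determine-tree (node l r) leaf x _ _ | w≡1 = ⊥-elim (<⇒≱ (+-mono-≤ (width-pos l) (width-pos r)) (≤-reflexive w≡1))
chords-determine-tree (node l r) (node l' r') x t⊆t' t'⊆t | w≡ = cong₂ node (chords-determine-tree l l' x l⊆l' l'⊆l) r≡r'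
  where
  split-not-below : ∀ l r l' r' → Chord (node l' r') x ⊆ᶜ Chord (node l r) x →
                    x + width l' + width r' ≡ x + width l + width r → ¬ (x + width l < x + width l')
  split-not-below l r l' r' ⊆ end≡ mid<mid' = chords-noncrossing (node l r) x
    (⊆ (inj₂ (inj₁ (inj₁ (refl , refl))))) (inj₂ (inj₂ (inj₁ (refl , refl))))
    (inj₁ (m<m+n x (width-pos l) , mid<mid' , subst (x + width l' <_) end≡ (m<m+n (x + width l') (width-pos r'))))
  end≡ : x + width l + width r ≡ x + width l' + width r'
  end≡ = trans (right-end x l r) (trans (cong (x +_) w≡) (sym (right-end x l' r')))
  mid≡ : x + width l ≡ x + width l'
  mid≡ with <-cmp (x + width l) (x + width l')
  ... | tri< lt _ _ = ⊥-elim (split-not-below l r l' r' t'⊆t (sym end≡) lt)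
  ... | tri≈ _ eq _ = eq
  ... | tri> _ _ gt = ⊥-elim (split-not-below l' r' l r t⊆t' end≡ gt)
  l⊆l' : Chord l x ⊆ᶜ Chord l' x
  l⊆l' {j = j} c = chord-left l' r' x (t⊆t' (inj₂ (inj₁ c))) (subst (j ≤_) mid≡ (proj₂ (proj₂ (chord-bounds c))))
  l'⊆l : Chord l' x ⊆ᶜ Chord l x
  l'⊆l {j = j} c = chord-left l r x (t'⊆t (inj₂ (inj₁ c))) (subst (j ≤_) (sym mid≡) (proj₂ (proj₂ (chord-bounds c))))
  r≡r' : r ≡ r'
  r≡r' = chords-determine-tree r r' (x + width l)
    (λ {i} {j} c → subst (λ z → Chord r' z i j) (sym mid≡)
                     (chord-right l' r' x (t⊆t' (inj₂ (inj₂ c))) (subst (_≤ i) mid≡ (proj₁ (chord-bounds c)))))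
    (λ {i} {j} c → chord-right l r x (t'⊆t (inj₂ (inj₂ (subst (λ z → Chord r' z i j) mid≡ c))))
                     (proj₁ (chord-bounds c)))

-- For trees of equal width one inclusion of chord sets suffices, by maximality.
chords-⊆-injective : ∀ t t' x → width t ≡ width t' → Chord t x ⊆ᶜ Chord t' x → t ≡ t'
chords-⊆-injective t t' x w≡ t⊆t' = chords-determine-tree t t' x t⊆t' t'⊆t
  where
  t'⊆t : Chord t' x ⊆ᶜ Chord t x
  t'⊆t {i} {j} c with chord? t x i j
  ... | yes c' = c'
  ... | no ¬c' with chord-bounds c
  ...   | x≤i , i<j , j≤ with chords-maximal t x i j x≤i i<j (subst (λ w → j ≤ x + w) (sym w≡) j≤) ¬c'
  ...     | k , l , ck , cr = ⊥-elim (chords-noncrossing t' x c (t⊆t' ck) cr)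

-- Conversely, a relation E on an interval [lo , hi] in which every E-segment (i , j)
-- with j > i + 1 is split by an apex c into E-segments (i , c) and (c , j) contains the
-- chord set of a tree spanning any E-segment: split recursively at apexes.
module TreeFromTriangles (E : ℕ → ℕ → Set) (lo hi : ℕ)
  (apex : ∀ {i j} → lo ≤ i → j ≤ hi → E i j → suc i < j → ∃ λ c → i < c × c < j × E i c × E c j) where

  SpanningTree : ℕ → ℕ → Set
  SpanningTree x y = ∃ λ t → x + width t ≡ y × Chord t x ⊆ᶜ E

  -- recursion on the length y - x, bounded by `fuel`
  spanning : ∀ fuel {x y} → y ∸ x ≤ fuel → x < y → lo ≤ x → y ≤ hi → E x y → SpanningTree x y
  spanning fuel {x} {y} len≤ x<y lo≤x y≤hi exy with suc x ≟ y
  ... | yes refl = leaf , +-comm x 1 , λ { (inj₁ (refl , refl)) → subst (E x) (+-comm 1 x) exy }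
  spanning (suc fuel) {x} {y} len≤ x<y lo≤x y≤hi exy | no x+1≢y
    with apex lo≤x y≤hi exy (≤∧≢⇒< x<y x+1≢y)
  ... | c , x<c , c<y , exc , ecy with left | right
    where
    left = spanning fuel (≤-pred (≤-trans (∸-monoˡ-< c<y (<⇒≤ x<c)) len≤)) x<c lo≤x (≤-trans (<⇒≤ c<y) y≤hi) exc
    right = spanning fuel (≤-pred (≤-trans (∸-monoʳ-< x<c (<⇒≤ c<y)) len≤)) c<y (≤-trans lo≤x (<⇒≤ x<c)) y≤hi ecy
  ... | l , x+wl≡c , l⊆E | r , c+wr≡y , r⊆E = node l r , end≡ , chords⊆E
    where
    end≡ : x + width (node l r) ≡ y
    end≡ = trans (sym (right-end x l r)) (trans (cong (_+ width r) x+wl≡c) c+wr≡y)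
    chords⊆E : Chord (node l r) x ⊆ᶜ E
    chords⊆E (inj₁ (refl , refl)) = subst (E x) (sym end≡) exy
    chords⊆E (inj₂ (inj₁ c)) = l⊆E c
    chords⊆E {i} {j} (inj₂ (inj₂ c)) = r⊆E (subst (λ z → Chord r z i j) x+wl≡c c)
  spanning zero {x} {y} len≤ x<y _ _ _ | no x+1≢y = ⊥-elim (<⇒≱ (∸-monoˡ-< x<y ≤-refl) (subst (y ∸ x ≤_) (sym (n∸n≡0 x)) len≤))

  spanning-tree : ∀ {x y} → x < y → lo ≤ x → y ≤ hi → E x y → SpanningTree x y
  spanning-tree {x} {y} = spanning (y ∸ x) ≤-refl

IsDiag : ℕ → ℕ → ℕ → Set
IsDiag m i j = suc i < j × j < m × (0 < i ⊎ suc j < m)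

diag-ordered : ∀ {m i j} → IsDiag m i j → i < j
diag-ordered (i+1<j , _) = <-trans (n<1+n _) i+1<j

record Triangulation (m : ℕ) (M : ℕ → ℕ → Set) : Set where
  field
    diagonal    : ∀ {i j} → M i j → IsDiag m i j
    noncrossing : ∀ {i j k l} → M i j → M k l → ¬ Crosses i j k l
    maximal     : ∀ i j → IsDiag m i j → ¬ M i j → ∃₂ λ k l → M k l × Crosses i j k l
    decide      : ∀ i j → Dec (M i j)

-- the edges of the subdivision: the sides of the polygon and the diagonals in M
Edge : ℕ → (ℕ → ℕ → Set) → ℕ → ℕ → Set
Edge m M i j = (suc i ≡ j) ⊎ ((i ≡ 0 × suc j ≡ m) ⊎ M i j)

crossing-is-diag : ∀ {m i j k l} → j < m → l < m → Crosses i j k l → IsDiag m k l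
crossing-is-diag j<m l<m (inj₁ (i<k , k<j , j<l)) = ≤-trans (s≤s k<j) j<l , l<m , inj₁ (≤-<-trans z≤n i<k)
crossing-is-diag j<m l<m (inj₂ (k<i , i<l , l<j)) = ≤-trans (s≤s k<i) i<l , l<m , inj₂ (≤-<-trans l<j j<m)

crossed-is-diag : ∀ {m i j k l} → j < m → l < m → Crosses i j k l → IsDiag m i j
crossed-is-diag j<m l<m (inj₁ (i<k , k<j , j<l)) = ≤-trans (s≤s i<k) k<j , j<m , inj₂ (≤-<-trans j<l l<m)
crossed-is-diag j<m l<m (inj₂ (k<i , i<l , l<j)) = ≤-trans (s≤s i<l) l<j , j<m , inj₁ (≤-<-trans z≤n k<i)

diag-not-side : ∀ {m M i j} → IsDiag m i j → Edge m M i j → M i j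
diag-not-side (i+1<j , _) (inj₁ refl) = ⊥-elim (<-irrefl refl i+1<j)
diag-not-side (_ , _ , inj₁ 0<i) (inj₂ (inj₁ (refl , _))) = ⊥-elim (<-irrefl refl 0<i)
diag-not-side (_ , _ , inj₂ j+1<m) (inj₂ (inj₁ (_ , j+1≡m))) = ⊥-elim (<-irrefl j+1≡m j+1<m)
diag-not-side _ (inj₂ (inj₂ mij)) = mij

largest : (P : ℕ → Set) → (∀ w → Dec (P w)) → ∀ x d → P x →
          ∃ λ y → x ≤ y × y ≤ x + d × P y × (∀ w → y < w → w ≤ x + d → ¬ P w)
largest P P? x zero px = x , ≤-refl , m≤m+n x 0 , px ,
  λ w x<w w≤ _ → <⇒≱ x<w (subst (w ≤_) (+-identityʳ x) w≤)
largest P P? x (suc d) px with P? (x + suc d)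
... | yes p = x + suc d , m≤m+n x (suc d) , ≤-refl , p , λ w y<w w≤ _ → <⇒≱ y<w w≤
... | no ¬p with largest P P? x d px
... | y , x≤y , y≤ , py , beyond = y , x≤y , ≤-trans y≤ (+-monoʳ-≤ x (n≤1+n d)) , py , beyond'
  where
  beyond' : ∀ w → y < w → w ≤ x + suc d → ¬ P w
  beyond' w y<w w≤ pw with w ≟ x + suc d
  ... | yes refl = ¬p pw
  ... | no w≢ = beyond w y<w (≤-pred (subst (w <_) (+-suc x d) (≤∧≢⇒< w≤ w≢))) pw

module TriangulationProperties {m : ℕ} {M : ℕ → ℕ → Set} (T : Triangulation m M) where
  open Triangulation T

  edge? : ∀ i j → Dec (Edge m M i j)
  edge? i j = (suc i ≟ j) ⊎-dec (((i ≟ 0) ×-dec (suc j ≟ m)) ⊎-dec decide i j)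

  oriented : ∀ {i j} → (M i j ⊎ M j i) → i < j → M i j
  oriented (inj₁ mij) _ = mij
  oriented (inj₂ mji) i<j = ⊥-elim (<-asym i<j (diag-ordered (diagonal mji)))

  edges-noncrossing : ∀ {i j k l} → j < m → l < m → Edge m M i j → Edge m M k l → ¬ Crosses i j k l
  edges-noncrossing j<m l<m eij ekl cr =
    noncrossing (diag-not-side {M = M} (crossed-is-diag j<m l<m cr) eij)
                (diag-not-side {M = M} (crossing-is-diag j<m l<m cr) ekl) cr

  -- If (x , y) is the last edge from x before z, then (y , z) is an edge: a diagonal
  -- crossing (y , z) would cross (x , z) or (x , y), or be an edge (x , w) with y < w < z.
  closing-edge : ∀ {x y z} → x < y → y < z → z < m → Edge m M x y → Edge m M x z →
                 (∀ w → y < w → w < z → ¬ Edge m M x w) → Edge m M y z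
  closing-edge {x} {y} {z} x<y y<z z<m exy exz beyond with suc y ≟ z | decide y z
  ... | yes y+1≡z | _ = inj₁ y+1≡z
  ... | no _ | yes myz = inj₂ (inj₂ myz)
  ... | no y+1≢z | no ¬myz with maximal y z (≤∧≢⇒< y<z y+1≢z , z<m , inj₁ (≤-<-trans z≤n x<y)) ¬myz
  ...   | k , l , mkl , inj₁ (y<k , k<z , z<l) =
          ⊥-elim (edges-noncrossing z<m l<m exz (inj₂ (inj₂ mkl)) (inj₁ (<-trans x<y y<k , k<z , z<l)))
    where l<m = proj₁ (proj₂ (diagonal mkl))
  ...   | k , l , mkl , inj₂ (k<y , y<l , l<z) with <-cmp k x
  ...     | tri< k<x _ _ = ⊥-elim (edges-noncrossing z<m l<m exz (inj₂ (inj₂ mkl)) (inj₂ (k<x , <-trans x<y y<l , l<z)))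
    where l<m = proj₁ (proj₂ (diagonal mkl))
  ...     | tri≈ _ refl _ = ⊥-elim (beyond l y<l l<z (inj₂ (inj₂ mkl)))
  ...     | tri> _ _ x<k = ⊥-elim (edges-noncrossing (<-trans y<z z<m) l<m exy (inj₂ (inj₂ mkl)) (inj₁ (x<k , k<y , y<l)))
    where l<m = proj₁ (proj₂ (diagonal mkl))

  -- Every edge (x , z) with z > x + 1 is the base of a triangle (x , y , z) of the
  -- subdivision, y being the largest vertex in (x , z) joined to x by an edge.
  apex : ∀ {x z} → suc x < z → z < m → Edge m M x z → ∃ λ y → x < y × y < z × Edge m M x y × Edge m M y z
  apex {x} {z} x+1<z z<m exz with z ∸ suc (suc x) | m+[n∸m]≡n x+1<z
  ... | d | refl with largest (Edge m M x) (edge? x) (suc x) d (inj₁ refl)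
  ...   | y , x<y , y≤ , exy , beyond =
          y , x<y , s≤s y≤ , exy , closing-edge x<y (s≤s y≤) z<m exy exz (λ w y<w w<z → beyond w y<w (≤-pred w<z))

RotatesBy : ℕ → ℕ → ℕ → ℕ → Set
RotatesBy m s a b = (a + s ≡ b) ⊎ (a + s ≡ b + m)

HasSegment : (ℕ → ℕ → Set) → ℕ → ℕ → Set
HasSegment M i j = M i j ⊎ M j i

segment-sym : ∀ {M i j} → HasSegment M i j → HasSegment M j i
segment-sym (inj₁ p) = inj₂ p
segment-sym (inj₂ p) = inj₁ p

Invariant : ℕ → ℕ → (ℕ → ℕ → Set) → Set
Invariant m s M = ∀ i j i' j' → i < m → j < m → i' < m → j' < m →
  RotatesBy m s i i' → RotatesBy m s j j' → (HasSegment M i j ⇔ HasSegment M i' j')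

module CentralTriangle (n : ℕ) (n≥1 : 1 ≤ n) {M : ℕ → ℕ → Set}
  (T : Triangulation (3 * n) M) (invariant : Invariant (3 * n) n M) where
  open Triangulation T
  open TriangulationProperties T

  m : ℕ
  m = 3 * n

  abstract
    m≡2n+n : m ≡ 2 * n + n
    m≡2n+n = three n
      where
      three : ∀ n → 3 * n ≡ 2 * n + n
      three = solve-∀

  x<x+n : ∀ x → x < x + n
  x<x+n x = m<m+n x n≥1

  rotated : ∀ {x z x' z'} → M x z → x' < m → z' < m →
            RotatesBy m n x x' → RotatesBy m n z z' → HasSegment M x' z'
  rotated {x} {z} {x'} {z'} mxz x'<m z'<m rx rz =
    to (invariant x z x' z' (<-trans (diag-ordered (diagonal mxz)) z<m) z<m x'<m z'<m rx rz) (inj₁ mxz)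
    where z<m = proj₁ (proj₂ (diagonal mxz))

  -- No edge has length strictly between n and 2n: it would cross its rotated copy.
  no-medium-edge : ∀ {x z} → z < m → Edge m M x z → x + n < z → z < x + 2 * n → ⊥
  no-medium-edge {x} _ (inj₁ refl) x+n<z _ = <⇒≱ x+n<z (subst (_≤ x + n) (+-comm x 1) (+-monoʳ-≤ x n≥1))
  no-medium-edge {x} _ (inj₂ (inj₁ (refl , z+1≡m))) _ z<2n = <⇒≱ (m<m+n (2 * n) n≥1) (subst (_≤ 2 * n) (trans z+1≡m m≡2n+n) z<2n)
  no-medium-edge {x} {z} z<m (inj₂ (inj₂ mxz)) x+n<z z<x+2n with z + n <? m
  ... | yes z+n<m = noncrossing mxz (oriented (rotated mxz (<-trans x+n<z z<m) z+n<m (inj₁ refl) (inj₁ refl)) (+-monoˡ-< n x<z))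
                                    (inj₁ (x<x+n x , x+n<z , x<x+n z))
    where x<z = <-trans (x<x+n x) x+n<z
  ... | no z+n≮m = noncrossing mxz (oriented (segment-sym {M = M} (rotated mxz (<-trans x+n<z z<m) (≤-<-trans (m∸n≤m z (2 * n)) z<m) (inj₁ refl) (inj₂ wrap))) w<x+n)
                                   (inj₂ (w<x , x<x+n x , x+n<z))
    where
    2n≤z : 2 * n ≤ z
    2n≤z = +-cancelʳ-≤ n (2 * n) z (subst (_≤ z + n) m≡2n+n (≮⇒≥ z+n≮m))
    w = z ∸ 2 * n
    wrap : z + n ≡ w + m
    wrap = trans (cong (_+ n) (sym (m∸n+n≡m 2n≤z))) (trans (+-assoc w (2 * n) n) (cong (w +_) (sym m≡2n+n)))
    w<x : w < x
    w<x = +-cancelʳ-< (2 * n) w x (subst (_< x + 2 * n) (sym (m∸n+n≡m 2n≤z)) z<x+2n)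
    w<x+n = <-trans w<x (x<x+n x)

  long⇒x+1<z : ∀ {x z} → x + 2 * n ≤ z → suc x < z
  long⇒x+1<z {x} {z} long = subst (_≤ z) (+-comm x 2) (≤-trans (+-monoʳ-≤ x (*-monoʳ-≤ 2 n≥1)) long)

  -- a central triangle (a , a + n , a + 2n), of which only the side (a , a + n) is needed
  Central : Set
  Central = ∃ λ a → a + 2 * n < m × Edge m M a (a + n)

  -- Descend from an edge (x , z) of length ≥ 2n: at its apex y either one of the two
  -- other sides is still that long, or both have length ≤ n (no medium edges), which
  -- forces y = x + n and z = x + 2n, so (x , y , z) is central.
  descend : ∀ fuel {x z} → z ∸ x ≤ fuel → x + 2 * n ≤ z → z < m → Edge m M x z → Central
  descend zero {x} {z} len≤0 long _ _ =
    ⊥-elim (<⇒≱ (≤-trans (≤-trans (s≤s z≤n) (*-monoʳ-≤ 2 n≥1)) (subst (_≤ z ∸ x) (m+n∸m≡n x (2 * n)) (∸-monoˡ-≤ x long))) len≤0)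
  descend (suc fuel) {x} {z} len≤ long z<m exz with apex (long⇒x+1<z long) z<m exz
  ... | y , x<y , y<z , exy , eyz with x + 2 * n ≤? y | y + 2 * n ≤? z
  ...   | yes long' | _ = descend fuel (≤-pred (≤-trans (∸-monoˡ-< y<z (<⇒≤ x<y)) len≤)) long' (<-trans y<z z<m) exy
  ...   | no _ | yes long' = descend fuel (≤-pred (≤-trans (∸-monoʳ-< x<y (<⇒≤ y<z)) len≤)) long' z<m eyz
  ...   | no short₁ | no short₂ = x , subst (_< m) z≡ z<m , subst (Edge m M x) y≡ exy
    where
    y≤x+n : y ≤ x + n
    y≤x+n = ≮⇒≥ (λ x+n<y → no-medium-edge (<-trans y<z z<m) exy x+n<y (≰⇒> short₁))
    z≤y+n : z ≤ y + n
    z≤y+n = ≮⇒≥ (λ y+n<z → no-medium-edge z<m eyz y+n<z (≰⇒> short₂))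
    x+2n≡ : x + 2 * n ≡ x + n + n
    x+2n≡ = trans (cong (x +_) (cong (n +_) (+-identityʳ n))) (sym (+-assoc x n n))
    z≡ : z ≡ x + 2 * n
    z≡ = ≤-antisym (≤-trans z≤y+n (subst (y + n ≤_) (sym x+2n≡) (+-monoˡ-≤ n y≤x+n))) long
    y≡ : y ≡ x + n
    y≡ = ≤-antisym y≤x+n (+-cancelʳ-≤ n (x + n) y (subst (_≤ y + n) x+2n≡ (≤-trans long z≤y+n)))

  -- start from the side (0 , m - 1), of length 3n - 1 ≥ 2n
  central : Central
  central = descend (m ∸ 1) ≤-refl 2n≤m-1 m-1<m (inj₂ (inj₁ (refl , 1+[m-1]≡m)))
    where
    1+[m-1]≡m : suc (m ∸ 1) ≡ m
    1+[m-1]≡m = m+[n∸m]≡n (≤-trans n≥1 (m≤m+n n (2 * n)))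
    m-1<m : m ∸ 1 < m
    m-1<m = subst (m ∸ 1 <_) 1+[m-1]≡m ≤-refl
    2n≤m-1 : 2 * n ≤ m ∸ 1
    2n≤m-1 = ≤-pred (subst (suc (2 * n) ≤_) (sym 1+[m-1]≡m)
                      (subst (suc (2 * n) ≤_) (sym m≡2n+n) (subst (_≤ 2 * n + n) (+-comm (2 * n) 1) (+-monoʳ-≤ (2 * n) n≥1))))

CrossesU : ℕ → ℕ → ℕ → ℕ → Set
CrossesU u₁ u₂ v₁ v₂ = Crosses u₁ u₂ v₁ v₂ ⊎ (Crosses u₂ u₁ v₁ v₂ ⊎ (Crosses u₁ u₂ v₂ v₁ ⊎ Crosses u₂ u₁ v₂ v₁))

crossesU-flipˡ : ∀ {u₁ u₂ v₁ v₂} → CrossesU u₁ u₂ v₁ v₂ → CrossesU u₂ u₁ v₁ v₂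
crossesU-flipˡ (inj₁ c) = inj₂ (inj₁ c)
crossesU-flipˡ (inj₂ (inj₁ c)) = inj₁ c
crossesU-flipˡ (inj₂ (inj₂ (inj₁ c))) = inj₂ (inj₂ (inj₂ c))
crossesU-flipˡ (inj₂ (inj₂ (inj₂ c))) = inj₂ (inj₂ (inj₁ c))

crossesU-sym : ∀ {u₁ u₂ v₁ v₂} → CrossesU u₁ u₂ v₁ v₂ → CrossesU v₁ v₂ u₁ u₂
crossesU-sym (inj₁ c) = inj₁ (crosses-sym c)
crossesU-sym (inj₂ (inj₁ c)) = inj₂ (inj₂ (inj₁ (crosses-sym c)))
crossesU-sym (inj₂ (inj₂ (inj₁ c))) = inj₂ (inj₁ (crosses-sym c))
crossesU-sym (inj₂ (inj₂ (inj₂ c))) = inj₂ (inj₂ (inj₂ (crosses-sym c)))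

crossesU-flipʳ : ∀ {u₁ u₂ v₁ v₂} → CrossesU u₁ u₂ v₁ v₂ → CrossesU u₁ u₂ v₂ v₁
crossesU-flipʳ c = crossesU-sym (crossesU-flipˡ (crossesU-sym c))

crossesU-ordered : ∀ {u₁ u₂ v₁ v₂} → u₁ < u₂ → v₁ < v₂ → CrossesU u₁ u₂ v₁ v₂ → Crosses u₁ u₂ v₁ v₂
crossesU-ordered _ _ (inj₁ c) = c
crossesU-ordered u₁<u₂ _ (inj₂ (inj₁ (inj₁ (u₂<v₁ , v₁<u₁ , _)))) = ⊥-elim (<-asym u₁<u₂ (<-trans u₂<v₁ v₁<u₁))
crossesU-ordered u₁<u₂ _ (inj₂ (inj₁ (inj₂ (_ , u₂<v₂ , v₂<u₁)))) = ⊥-elim (<-asym u₁<u₂ (<-trans u₂<v₂ v₂<u₁))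
crossesU-ordered _ v₁<v₂ (inj₂ (inj₂ (inj₁ (inj₁ (_ , v₂<u₂ , u₂<v₁))))) = ⊥-elim (<-asym v₁<v₂ (<-trans v₂<u₂ u₂<v₁))
crossesU-ordered _ v₁<v₂ (inj₂ (inj₂ (inj₁ (inj₂ (v₂<u₁ , u₁<v₁ , _))))) = ⊥-elim (<-asym v₁<v₂ (<-trans v₂<u₁ u₁<v₁))
crossesU-ordered u₁<u₂ _ (inj₂ (inj₂ (inj₂ (inj₁ (u₂<v₂ , v₂<u₁ , _))))) = ⊥-elim (<-asym u₁<u₂ (<-trans u₂<v₂ v₂<u₁))
crossesU-ordered u₁<u₂ _ (inj₂ (inj₂ (inj₂ (inj₂ (_ , u₂<v₁ , v₁<u₁))))) = ⊥-elim (<-asym u₁<u₂ (<-trans u₂<v₁ v₁<u₁))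

record Distinct (u₁ u₂ v₁ v₂ : ℕ) : Set where
  field
    u₁≢u₂ : u₁ ≢ u₂
    u₁≢v₁ : u₁ ≢ v₁
    u₁≢v₂ : u₁ ≢ v₂
    u₂≢v₁ : u₂ ≢ v₁
    u₂≢v₂ : u₂ ≢ v₂
    v₁≢v₂ : v₁ ≢ v₂

distinct-flipˡ : ∀ {u₁ u₂ v₁ v₂} → Distinct u₁ u₂ v₁ v₂ → Distinct u₂ u₁ v₁ v₂
distinct-flipˡ d = record { u₁≢u₂ = ≢-sym u₁≢u₂ ; u₁≢v₁ = u₂≢v₁ ; u₁≢v₂ = u₂≢v₂ ; u₂≢v₁ = u₁≢v₁ ; u₂≢v₂ = u₁≢v₂ ; v₁≢v₂ = v₁≢v₂ }
  where open Distinct d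

distinct-flipʳ : ∀ {u₁ u₂ v₁ v₂} → Distinct u₁ u₂ v₁ v₂ → Distinct u₁ u₂ v₂ v₁
distinct-flipʳ d = record { u₁≢u₂ = u₁≢u₂ ; u₁≢v₁ = u₁≢v₂ ; u₁≢v₂ = u₁≢v₁ ; u₂≢v₁ = u₂≢v₂ ; u₂≢v₂ = u₂≢v₁ ; v₁≢v₂ = ≢-sym v₁≢v₂ }
  where open Distinct d

crosses-distinct : ∀ {u₁ u₂ v₁ v₂} → Crosses u₁ u₂ v₁ v₂ → Distinct u₁ u₂ v₁ v₂
crosses-distinct (inj₁ (u₁<v₁ , v₁<u₂ , u₂<v₂)) = record
  { u₁≢u₂ = <⇒≢ (<-trans u₁<v₁ v₁<u₂) ; u₁≢v₁ = <⇒≢ u₁<v₁ ; u₁≢v₂ = <⇒≢ (<-trans u₁<v₁ (<-trans v₁<u₂ u₂<v₂))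
  ; u₂≢v₁ = ≢-sym (<⇒≢ v₁<u₂) ; u₂≢v₂ = <⇒≢ u₂<v₂ ; v₁≢v₂ = <⇒≢ (<-trans v₁<u₂ u₂<v₂) }
crosses-distinct (inj₂ (v₁<u₁ , u₁<v₂ , v₂<u₂)) = record
  { u₁≢u₂ = <⇒≢ (<-trans u₁<v₂ v₂<u₂) ; u₁≢v₁ = ≢-sym (<⇒≢ v₁<u₁) ; u₁≢v₂ = <⇒≢ u₁<v₂
  ; u₂≢v₁ = ≢-sym (<⇒≢ (<-trans v₁<u₁ (<-trans u₁<v₂ v₂<u₂))) ; u₂≢v₂ = ≢-sym (<⇒≢ v₂<u₂) ; v₁≢v₂ = <⇒≢ (<-trans v₁<u₁ u₁<v₂) }

crossesU-distinct : ∀ {u₁ u₂ v₁ v₂} → CrossesU u₁ u₂ v₁ v₂ → Distinct u₁ u₂ v₁ v₂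
crossesU-distinct (inj₁ c) = crosses-distinct c
crossesU-distinct (inj₂ (inj₁ c)) = distinct-flipˡ (crosses-distinct c)
crossesU-distinct (inj₂ (inj₂ (inj₁ c))) = distinct-flipʳ (crosses-distinct c)
crossesU-distinct (inj₂ (inj₂ (inj₂ c))) = distinct-flipˡ (distinct-flipʳ (crosses-distinct c))

Between : ℕ → ℕ → ℕ → Set
Between u v₁ v₂ = (v₁ < u × u < v₂) ⊎ (v₂ < u × u < v₁)

crossesU-from-below : ∀ {b u v₁ v₂} → b < v₁ → b < v₂ → CrossesU b u v₁ v₂ ⇔ Between u v₁ v₂
crossesU-from-below {b} {u} {v₁} {v₂} b<v₁ b<v₂ = mk⇔ between crosses
  where
  between : CrossesU b u v₁ v₂ → Between u v₁ v₂
  between (inj₁ (inj₁ (_ , v₁<u , u<v₂))) = inj₁ (v₁<u , u<v₂)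
  between (inj₁ (inj₂ (v₁<b , _))) = ⊥-elim (<-asym v₁<b b<v₁)
  between (inj₂ (inj₁ (inj₁ (_ , v₁<b , _)))) = ⊥-elim (<-asym v₁<b b<v₁)
  between (inj₂ (inj₁ (inj₂ (_ , _ , v₂<b)))) = ⊥-elim (<-asym v₂<b b<v₂)
  between (inj₂ (inj₂ (inj₁ (inj₁ (_ , v₂<u , u<v₁))))) = inj₂ (v₂<u , u<v₁)
  between (inj₂ (inj₂ (inj₁ (inj₂ (v₂<b , _))))) = ⊥-elim (<-asym v₂<b b<v₂)
  between (inj₂ (inj₂ (inj₂ (inj₁ (_ , v₂<b , _))))) = ⊥-elim (<-asym v₂<b b<v₂)
  between (inj₂ (inj₂ (inj₂ (inj₂ (_ , _ , v₁<b))))) = ⊥-elim (<-asym v₁<b b<v₁)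
  crosses : Between u v₁ v₂ → CrossesU b u v₁ v₂
  crosses (inj₁ (v₁<u , u<v₂)) = inj₁ (inj₁ (b<v₁ , v₁<u , u<v₂))
  crosses (inj₂ (v₂<u , u<v₁)) = inj₂ (inj₂ (inj₁ (inj₁ (b<v₂ , v₂<u , u<v₁))))

crossesU-from-above : ∀ {B u v₁ v₂} → v₁ < B → v₂ < B → CrossesU B u v₁ v₂ ⇔ Between u v₁ v₂
crossesU-from-above {B} {u} {v₁} {v₂} v₁<B v₂<B = mk⇔ between crosses
  where
  between : CrossesU B u v₁ v₂ → Between u v₁ v₂
  between (inj₁ (inj₁ (B<v₁ , _))) = ⊥-elim (<-asym B<v₁ v₁<B)
  between (inj₁ (inj₂ (_ , B<v₂ , _))) = ⊥-elim (<-asym B<v₂ v₂<B)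
  between (inj₂ (inj₁ (inj₁ (_ , _ , B<v₂)))) = ⊥-elim (<-asym B<v₂ v₂<B)
  between (inj₂ (inj₁ (inj₂ (v₁<u , u<v₂ , _)))) = inj₁ (v₁<u , u<v₂)
  between (inj₂ (inj₂ (inj₁ (inj₁ (B<v₂ , _))))) = ⊥-elim (<-asym B<v₂ v₂<B)
  between (inj₂ (inj₂ (inj₁ (inj₂ (_ , B<v₁ , _))))) = ⊥-elim (<-asym B<v₁ v₁<B)
  between (inj₂ (inj₂ (inj₂ (inj₁ (_ , _ , B<v₁))))) = ⊥-elim (<-asym B<v₁ v₁<B)
  between (inj₂ (inj₂ (inj₂ (inj₂ (v₂<u , u<v₁ , _))))) = inj₂ (v₂<u , u<v₁)
  crosses : Between u v₁ v₂ → CrossesU B u v₁ v₂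
  crosses (inj₁ (v₁<u , u<v₂)) = inj₂ (inj₁ (inj₂ (v₁<u , u<v₂ , v₂<B)))
  crosses (inj₂ (v₂<u , u<v₁)) = inj₂ (inj₂ (inj₂ (inj₂ (v₂<u , u<v₁ , v₁<B))))

-- Crossing is invariant under the cyclic relabellings of the m-gon: relabelling
-- the vertices below a by adding m does not change which segments cross.
module CyclicRelabelling (m : ℕ) where

  InsideAbove : ℕ → ℕ → Set
  InsideAbove b w = b < w × w < b + m

  crossesU-move : ∀ {b u v₁ v₂} → InsideAbove b u → InsideAbove b v₁ → InsideAbove b v₂ →
                  CrossesU b u v₁ v₂ ⇔ CrossesU (b + m) u v₁ v₂
  crossesU-move (_ , _) (b<v₁ , v₁<B) (b<v₂ , v₂<B) =
    ⇔-sym (crossesU-from-above v₁<B v₂<B) ⇔-∘ crossesU-from-below b<v₁ b<v₂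

  ⇔-flipˡ : ∀ {u₁ u₂ v₁ v₂ u₁' u₂' v₁' v₂'} → CrossesU u₁ u₂ v₁ v₂ ⇔ CrossesU u₁' u₂' v₁' v₂' →
            CrossesU u₂ u₁ v₁ v₂ ⇔ CrossesU u₂' u₁' v₁' v₂'
  ⇔-flipˡ e = mk⇔ (λ c → crossesU-flipˡ (to e (crossesU-flipˡ c))) (λ c → crossesU-flipˡ (from e (crossesU-flipˡ c)))

  ⇔-swap : ∀ {u₁ u₂ v₁ v₂ u₁' u₂' v₁' v₂'} → CrossesU u₁ u₂ v₁ v₂ ⇔ CrossesU u₁' u₂' v₁' v₂' →
           CrossesU v₁ v₂ u₁ u₂ ⇔ CrossesU v₁' v₂' u₁' u₂'
  ⇔-swap e = mk⇔ (λ c → crossesU-sym (to e (crossesU-sym c))) (λ c → crossesU-sym (from e (crossesU-sym c)))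

  -- w becomes w' in the passage from cut point b to cut point b + 1
  Moves : ℕ → ℕ → ℕ → Set
  Moves b w w' = (w ≡ b × w' ≡ b + m) ⊎ (w ≢ b × w' ≡ w)

  Inside : ℕ → ℕ → Set
  Inside b w = b ≤ w × w < b + m

  inside-above : ∀ {b w} → Inside b w → w ≢ b → InsideAbove b w
  inside-above (b≤w , w<B) w≢b = ≤∧≢⇒< b≤w (≢-sym w≢b) , w<B

  both-false : ∀ {A B : Set} → ¬ A → ¬ B → A ⇔ B
  both-false ¬a ¬b = mk⇔ (λ a → ⊥-elim (¬a a)) (λ b → ⊥-elim (¬b b))

  coincide : ∀ {u₁ u₂ v₁ v₂} {x : ℕ} → (Distinct u₁ u₂ v₁ v₂ → x ≢ x) → ¬ CrossesU u₁ u₂ v₁ v₂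
  coincide ≢ c = ≢ (crossesU-distinct c) refl

  -- One step of relabelling preserves crossings: at most one end moves, since the
  -- ends of crossing segments are distinct.
  move-step : ∀ {b u₁ u₂ v₁ v₂ u₁' u₂' v₁' v₂'} → Inside b u₁ → Inside b u₂ → Inside b v₁ → Inside b v₂ →
              Moves b u₁ u₁' → Moves b u₂ u₂' → Moves b v₁ v₁' → Moves b v₂ v₂' →
              CrossesU u₁ u₂ v₁ v₂ ⇔ CrossesU u₁' u₂' v₁' v₂'
  move-step _ _ _ _ (inj₂ (_ , refl)) (inj₂ (_ , refl)) (inj₂ (_ , refl)) (inj₂ (_ , refl)) = mk⇔ (λ c → c) (λ c → c)
  move-step r₁ r₂ r₃ r₄ (inj₁ (refl , refl)) (inj₂ (n₂ , refl)) (inj₂ (n₃ , refl)) (inj₂ (n₄ , refl)) =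
    crossesU-move (inside-above r₂ n₂) (inside-above r₃ n₃) (inside-above r₄ n₄)
  move-step r₁ r₂ r₃ r₄ (inj₂ (n₁ , refl)) (inj₁ (refl , refl)) (inj₂ (n₃ , refl)) (inj₂ (n₄ , refl)) =
    ⇔-flipˡ (crossesU-move (inside-above r₁ n₁) (inside-above r₃ n₃) (inside-above r₄ n₄))
  move-step r₁ r₂ r₃ r₄ (inj₂ (n₁ , refl)) (inj₂ (n₂ , refl)) (inj₁ (refl , refl)) (inj₂ (n₄ , refl)) =
    ⇔-swap (crossesU-move (inside-above r₄ n₄) (inside-above r₁ n₁) (inside-above r₂ n₂))
  move-step r₁ r₂ r₃ r₄ (inj₂ (n₁ , refl)) (inj₂ (n₂ , refl)) (inj₂ (n₃ , refl)) (inj₁ (refl , refl)) =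
    ⇔-swap (⇔-flipˡ (crossesU-move (inside-above r₃ n₃) (inside-above r₁ n₁) (inside-above r₂ n₂)))
  move-step _ _ _ _ (inj₁ (refl , refl)) (inj₁ (refl , refl)) _ _ = both-false (coincide Distinct.u₁≢u₂) (coincide Distinct.u₁≢u₂)
  move-step _ _ _ _ (inj₁ (refl , refl)) _ (inj₁ (refl , refl)) _ = both-false (coincide Distinct.u₁≢v₁) (coincide Distinct.u₁≢v₁)
  move-step _ _ _ _ (inj₁ (refl , refl)) _ _ (inj₁ (refl , refl)) = both-false (coincide Distinct.u₁≢v₂) (coincide Distinct.u₁≢v₂)
  move-step _ _ _ _ _ (inj₁ (refl , refl)) (inj₁ (refl , refl)) _ = both-false (coincide Distinct.u₂≢v₁) (coincide Distinct.u₂≢v₁)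
  move-step _ _ _ _ _ (inj₁ (refl , refl)) _ (inj₁ (refl , refl)) = both-false (coincide Distinct.u₂≢v₂) (coincide Distinct.u₂≢v₂)
  move-step _ _ _ _ _ _ (inj₁ (refl , refl)) (inj₁ (refl , refl)) = both-false (coincide Distinct.v₁≢v₂) (coincide Distinct.v₁≢v₂)

  -- the label of v when the polygon is cut at a: the vertices below a move up by m
  unfold : ℕ → ℕ → ℕ
  unfold a v with v <? a
  ... | yes _ = v + m
  ... | no _ = v

  unfold-below : ∀ {a v} → v < a → unfold a v ≡ v + m
  unfold-below {a} {v} v<a with v <? a
  ... | yes _ = refl
  ... | no v≮a = ⊥-elim (v≮a v<a)

  unfold-above : ∀ {a v} → a ≤ v → unfold a v ≡ v
  unfold-above {a} {v} a≤v with v <? a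
  ... | yes v<a = ⊥-elim (<⇒≱ v<a a≤v)
  ... | no _ = refl

  unfold-inside : ∀ {a v} → a < m → v < m → Inside a (unfold a v)
  unfold-inside {a} {v} a<m v<m with v <? a
  ... | yes v<a = ≤-trans (<⇒≤ a<m) (m≤n+m m v) , +-monoˡ-< m v<a
  ... | no v≮a = ≮⇒≥ v≮a , <-≤-trans v<m (m≤n+m m a)

  unfold-moves : ∀ {a v} → a < m → v < m → Moves a (unfold a v) (unfold (suc a) v)
  unfold-moves {a} {v} a<m v<m with <-cmp v a
  ... | tri< v<a _ _ = inj₂ (below≢ , trans (unfold-below (m<n⇒m<1+n v<a)) (sym (unfold-below v<a)))
    where
    below≢ : unfold a v ≢ a
    below≢ e = <⇒≱ a<m (subst (m ≤_) (trans (sym (unfold-below v<a)) e) (m≤n+m m v))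
  ... | tri≈ _ refl _ = inj₁ (unfold-above ≤-refl , unfold-below ≤-refl)
  ... | tri> _ _ a<v = inj₂ (above≢ , trans (unfold-above a<v) (sym (unfold-above (<⇒≤ a<v))))
    where
    above≢ : unfold a v ≢ a
    above≢ e = <-irrefl (sym (trans (sym (unfold-above (<⇒≤ a<v))) e)) a<v

  unfold-crossesU : ∀ a → a ≤ m → ∀ {u₁ u₂ v₁ v₂} → u₁ < m → u₂ < m → v₁ < m → v₂ < m →
                    CrossesU u₁ u₂ v₁ v₂ ⇔ CrossesU (unfold a u₁) (unfold a u₂) (unfold a v₁) (unfold a v₂)
  unfold-crossesU zero _ {u₁} {u₂} {v₁} {v₂} _ _ _ _ rewrite unfold-above {0} {u₁} z≤n | unfold-above {0} {u₂} z≤n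
    | unfold-above {0} {v₁} z≤n | unfold-above {0} {v₂} z≤n = mk⇔ (λ c → c) (λ c → c)
  unfold-crossesU (suc a) a<m u₁<m u₂<m v₁<m v₂<m =
    move-step (unfold-inside a<m u₁<m) (unfold-inside a<m u₂<m) (unfold-inside a<m v₁<m) (unfold-inside a<m v₂<m)
              (unfold-moves a<m u₁<m) (unfold-moves a<m u₂<m) (unfold-moves a<m v₁<m) (unfold-moves a<m v₂<m)
    ⇔-∘ unfold-crossesU a (<⇒≤ a<m) u₁<m u₂<m v₁<m v₂<m

search≤ : (P : ℕ → Set) → (∀ p → Dec (P p)) → ∀ N → Dec (∃ λ p → p ≤ N × P p)
search≤ P P? zero with P? 0
... | yes p0 = yes (0 , z≤n , p0)
... | no ¬p0 = no λ { (.0 , z≤n , p0) → ¬p0 p0 }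
search≤ P P? (suc N) with P? (suc N) | search≤ P P? N
... | yes pN | _ = yes (suc N , ≤-refl , pN)
... | no _ | yes (p , p≤N , pp) = yes (p , m≤n⇒m≤1+n p≤N , pp)
... | no ¬pN | no ¬below = no λ { (p , p≤1+N , pp) → none p p≤1+N pp }
  where
  none : ∀ p → p ≤ suc N → ¬ P p
  none p p≤1+N pp with p ≟ suc N
  ... | yes refl = ¬pN pp
  ... | no p≢ = ¬below (p , ≤-pred (≤∧≢⇒< p≤1+N p≢) , pp)

-- A tree B of width m placed at a spans the polygon a , a + 1 , ... , a + m; folding
-- its chords modulo m (the chord ending at a + m ends at a) gives a triangulation of
-- the m-gon.  Crossings are detected after cutting the m-gon at a (CyclicRelabelling).
module Folding (m : ℕ) (B : Tree) (width≡m : width B ≡ m) (a : ℕ) (a<m : a < m) where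
  open CyclicRelabelling m

  -- reduction modulo m of a label p < 2m
  fold : ℕ → ℕ
  fold p with p <? m
  ... | yes _ = p
  ... | no _ = p ∸ m

  fold-below : ∀ {p} → p < m → fold p ≡ p
  fold-below {p} p<m with p <? m
  ... | yes _ = refl
  ... | no p≮m = ⊥-elim (p≮m p<m)

  fold-above : ∀ {p} → m ≤ p → fold p ≡ p ∸ m
  fold-above {p} m≤p with p <? m
  ... | yes p<m = ⊥-elim (<⇒≱ p<m m≤p)
  ... | no _ = refl

  fold-+m : ∀ {w} → fold (w + m) ≡ w
  fold-+m {w} = trans (fold-above (m≤n+m m w)) (m+n∸n≡m w m)

  fold-range : ∀ {p} → p < m + m → fold p < m
  fold-range {p} p<2m with p <? m
  ... | yes p<m = p<m
  ... | no p≮m = +-cancelʳ-< m (p ∸ m) m (subst (_< m + m) (sym (m∸n+n≡m (≮⇒≥ p≮m))) p<2m)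

  fold-unfold : ∀ {v} → v < m → fold (unfold a v) ≡ v
  fold-unfold {v} v<m with v <? a
  ... | yes _ = fold-+m
  ... | no _ = fold-below v<m

  unfold-fold : ∀ {p} → a ≤ p → p < a + m → unfold a (fold p) ≡ p
  unfold-fold {p} a≤p p<a+m with p <? m
  ... | yes _ = unfold-above a≤p
  ... | no p≮m = trans (unfold-below (+-cancelʳ-< m (p ∸ m) a (subst (_< a + m) (sym p∸m+m) p<a+m))) p∸m+m
    where p∸m+m = m∸n+n≡m (≮⇒≥ p≮m)

  fold-suc : ∀ {p} → suc p < m + m → suc (fold p) ≡ fold (suc p) ⊎ (suc (fold p) ≡ m × fold (suc p) ≡ 0)
  fold-suc {p} p+1<2m with <-cmp (suc p) m
  ... | tri< p+1<m _ _ = inj₁ (trans (cong suc (fold-below (<-trans (n<1+n p) p+1<m))) (sym (fold-below p+1<m)))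
  ... | tri≈ _ p+1≡m _ = inj₂ (trans (cong suc (fold-below (subst (p <_) p+1≡m ≤-refl))) p+1≡m ,
                               trans (cong fold p+1≡m) (trans (fold-above ≤-refl) (n∸n≡0 m)))
  ... | tri> _ _ m<p+1 = inj₁ (trans (cong suc (fold-above (≤-pred m<p+1)))
                           (trans (sym (+-∸-assoc 1 (≤-pred m<p+1))) (sym (fold-above (<⇒≤ m<p+1)))))

  a+m<2m : a + m < m + m
  a+m<2m = +-monoˡ-< m a<m

  fold-range≤ : ∀ {p} → p ≤ a + m → fold p < m
  fold-range≤ p≤ = fold-range (≤-<-trans p≤ a+m<2m)

  bounds : ∀ {p q} → Chord B a p q → a ≤ p × p < q × q ≤ a + m
  bounds c with chord-bounds c
  ... | a≤p , p<q , q≤ = a≤p , p<q , subst (λ w → _ ≤ a + w) width≡m q≤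

  FoldsTo : ℕ → ℕ → ℕ → ℕ → Set
  FoldsTo p q i j = (fold p ≡ i × fold q ≡ j) ⊎ (fold p ≡ j × fold q ≡ i)

  FoldedChord : ℕ → ℕ → Set
  FoldedChord i j = ∃ λ p → p ≤ a + m × ∃ λ q → q ≤ a + m × Chord B a p q × FoldsTo p q i j

  Folded : ℕ → ℕ → Set
  Folded i j = IsDiag m i j × FoldedChord i j

  folded? : ∀ i j → Dec (Folded i j)
  folded? i j = diag? ×-dec search≤ _ (λ p → search≤ _ (λ q → chord? B a p q ×-dec foldsTo? p q) (a + m)) (a + m)
    where
    diag? = (suc i <? j) ×-dec ((j <? m) ×-dec ((0 <? i) ⊎-dec (suc j <? m)))
    foldsTo? : ∀ p q → Dec (FoldsTo p q i j)
    foldsTo? p q = ((fold p ≟ i) ×-dec (fold q ≟ j)) ⊎-dec ((fold p ≟ j) ×-dec (fold q ≟ i))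

  -- relabelling of [a , a + m] into [a , a + m): only a + m changes, to a
  relabel : ℕ → ℕ
  relabel p = unfold a (fold p)

  relabel-cases : ∀ {p} → a ≤ p → p ≤ a + m → (p < a + m × relabel p ≡ p) ⊎ (p ≡ a + m × relabel p ≡ a)
  relabel-cases {p} a≤p p≤ with p ≟ a + m
  ... | yes refl = inj₂ (refl , trans (cong (unfold a) fold-+m) (unfold-above ≤-refl))
  ... | no p≢ = inj₁ (≤∧≢⇒< p≤ p≢ , unfold-fold a≤p (≤∧≢⇒< p≤ p≢))

  orientˡ : ∀ {p q i j k l} → FoldsTo p q i j → CrossesU i j k l → CrossesU (fold p) (fold q) k l
  orientˡ (inj₁ (refl , refl)) c = c
  orientˡ (inj₂ (refl , refl)) c = crossesU-flipˡ c

  unorientˡ : ∀ {p q i j k l} → FoldsTo p q i j → CrossesU (fold p) (fold q) k l → CrossesU i j k l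
  unorientˡ (inj₁ (refl , refl)) c = c
  unorientˡ (inj₂ (refl , refl)) c = crossesU-flipˡ c

  orientʳ : ∀ {p q i j k l} → FoldsTo p q k l → CrossesU i j k l → CrossesU i j (fold p) (fold q)
  orientʳ o c = crossesU-sym (orientˡ o (crossesU-sym c))

  top-crossing : ∀ {p p' q'} → a ≤ p → a ≤ p' → q' < a + m → p' < q' → CrossesU p a p' q' → Crosses p (a + m) p' q'
  top-crossing a≤p a≤p' q'<top p'<q' c
    with crossesU-ordered (≤∧≢⇒< a≤p (≢-sym (Distinct.u₁≢u₂ (crossesU-distinct c)))) p'<q' (crossesU-flipˡ c)
  ... | inj₁ (_ , p'<p , p<q') = inj₂ (p'<p , p<q' , q'<top)
  ... | inj₂ (p'<a , _) = ⊥-elim (<⇒≱ p'<a a≤p')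

  relabelled-crossing : ∀ {p q p' q'} → Chord B a p q → Chord B a p' q' →
                        CrossesU (relabel p) (relabel q) (relabel p') (relabel q') → Crosses p q p' q'
  relabelled-crossing c c' cr with bounds c | bounds c'
  ... | a≤p , p<q , q≤ | a≤p' , p'<q' , q'≤
    with relabel-cases a≤p (≤-trans (<⇒≤ p<q) q≤) | relabel-cases (≤-trans a≤p (<⇒≤ p<q)) q≤
       | relabel-cases a≤p' (≤-trans (<⇒≤ p'<q') q'≤) | relabel-cases (≤-trans a≤p' (<⇒≤ p'<q')) q'≤
  ... | inj₂ (refl , _) | _ | _ | _ = ⊥-elim (<⇒≱ p<q q≤)
  ... | inj₁ _ | _ | inj₂ (refl , _) | _ = ⊥-elim (<⇒≱ p'<q' q'≤)
  ... | inj₁ (_ , e₁) | inj₁ (_ , e₂) | inj₁ (_ , e₃) | inj₁ (_ , e₄) rewrite e₁ | e₂ | e₃ | e₄ =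
        crossesU-ordered p<q p'<q' cr
  ... | inj₁ (_ , e₁) | inj₂ (refl , e₂) | inj₁ (_ , e₃) | inj₁ (q'<top , e₄) rewrite e₁ | e₂ | e₃ | e₄ =
        top-crossing a≤p a≤p' q'<top p'<q' cr
  ... | inj₁ (_ , e₁) | inj₁ (q<top , e₂) | inj₁ (_ , e₃) | inj₂ (refl , e₄) rewrite e₁ | e₂ | e₃ | e₄ =
        crosses-sym (top-crossing a≤p' a≤p q<top p<q (crossesU-sym cr))
  ... | inj₁ (_ , e₁) | inj₂ (refl , e₂) | inj₁ (_ , e₃) | inj₂ (refl , e₄) rewrite e₁ | e₂ | e₃ | e₄ =
        ⊥-elim (Distinct.u₂≢v₂ (crossesU-distinct cr) refl)

  -- relabelling is a cyclic relabelling, so it preserves crossings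
  relabel-crossesU : ∀ {p q p' q'} → p ≤ a + m → q ≤ a + m → p' ≤ a + m → q' ≤ a + m →
    CrossesU (fold p) (fold q) (fold p') (fold q') ⇔ CrossesU (relabel p) (relabel q) (relabel p') (relabel q')
  relabel-crossesU p≤ q≤ p'≤ q'≤ = unfold-crossesU a (<⇒≤ a<m) (fold-range≤ p≤) (fold-range≤ q≤) (fold-range≤ p'≤) (fold-range≤ q'≤)

  -- folded diagonals do not cross: lift a crossing to the chords of B
  folded-noncrossing : ∀ {i j k l} → Folded i j → Folded k l → ¬ Crosses i j k l
  folded-noncrossing (_ , p , p≤ , q , q≤ , c , o) (_ , p' , p'≤ , q' , q'≤ , c' , o') cr =
    chords-noncrossing B a c c' (relabelled-crossing c c' (to (relabel-crossesU p≤ q≤ p'≤ q'≤) (orientʳ o' (orientˡ o (inj₁ cr)))))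

  relabel-top : relabel (a + m) ≡ a
  relabel-top = trans (cong (unfold a) fold-+m) (unfold-above ≤-refl)

  relabelled : ∀ {p q k l} → Inside a p → Inside a q → Inside a k → Inside a l →
               CrossesU p q k l → CrossesU (relabel p) (relabel q) (relabel k) (relabel l)
  relabelled (a≤p , p<) (a≤q , q<) (a≤k , k<) (a≤l , l<) c
    rewrite unfold-fold a≤p p< | unfold-fold a≤q q< | unfold-fold a≤k k< | unfold-fold a≤l l< = c

  a<a+m : a < a + m
  a<a+m = m<m+n a (≤-trans (s≤s z≤n) a<m)

  relabelled-top : ∀ {p q k} → Inside a p → Inside a q → Inside a k →
                   CrossesU p q k a → CrossesU (relabel p) (relabel q) (relabel k) (relabel (a + m))
  relabelled-top (a≤p , p<) (a≤q , q<) (a≤k , k<) c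
    rewrite unfold-fold a≤p p< | unfold-fold a≤q q< | unfold-fold a≤k k< | relabel-top = c

  top≤ : a + m ≤ a + width B
  top≤ = ≤-reflexive (cong (a +_) (sym width≡m))

  CrossingChord : ℕ → ℕ → Set
  CrossingChord p₀ q₀ = ∃₂ λ k l → k ≤ a + m × l ≤ a + m × Chord B a k l ×
                                   CrossesU (relabel p₀) (relabel q₀) (relabel k) (relabel l)

  -- When p₀ = a the segment
  -- (q₀ , a + m) has the same fold, is not a chord either, and is used instead.
  crossing-chord : ∀ {p₀ q₀} → a ≤ p₀ → p₀ < q₀ → q₀ < a + m → ¬ Chord B a p₀ q₀ →
                   (p₀ ≡ a → ¬ Chord B a q₀ (a + m)) → CrossingChord p₀ q₀
  crossing-chord {p₀} {q₀} a≤p₀ p₀<q₀ q₀<top ¬c ¬c' with chords-maximal B a p₀ q₀ a≤p₀ p₀<q₀ (≤-trans (<⇒≤ q₀<top) top≤) ¬c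
  ... | k , l , ck , cr with bounds ck
  ... | a≤k , k<l , l≤top with l ≟ a + m
  ...   | no l≢top = k , l , ≤-trans (<⇒≤ k<l) l≤top , l≤top , ck ,
                     relabelled (a≤p₀ , <-trans p₀<q₀ q₀<top) (≤-trans a≤p₀ (<⇒≤ p₀<q₀) , q₀<top) (a≤k , <-≤-trans k<l l≤top)
                                (≤-trans a≤k (<⇒≤ k<l) , ≤∧≢⇒< l≤top l≢top) (inj₁ cr)
  ...   | yes refl with cr
  ...     | inj₂ (_ , _ , top<q₀) = ⊥-elim (<-asym top<q₀ q₀<top)
  ...     | inj₁ (p₀<k , k<q₀ , _) with a ≟ p₀
  ...       | no a≢p₀ = k , a + m , <⇒≤ k<l , ≤-refl , ck ,
                          relabelled-top (a≤p₀ , <-trans p₀<q₀ q₀<top) (≤-trans a≤p₀ (<⇒≤ p₀<q₀) , q₀<top) (a≤k , k<l)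
                                         (crossesU-flipʳ (crossesU-sym (inj₁ (inj₁ (≤∧≢⇒< a≤p₀ a≢p₀ , p₀<k , k<q₀)))))
  ...       | yes refl with chords-maximal B a q₀ (a + m) (≤-trans a≤p₀ (<⇒≤ p₀<q₀)) q₀<top top≤ (¬c' refl)
  ...         | k' , l' , ck' , inj₁ (_ , _ , top<l') = ⊥-elim (<⇒≱ top<l' (proj₂ (proj₂ (bounds ck'))))
  ...         | k' , l' , ck' , inj₂ (k'<q₀ , q₀<l' , l'<top) with a ≟ k'
  ...           | yes refl = ⊥-elim (chords-noncrossing B a ck' ck (inj₁ (p₀<k , <-trans k<q₀ q₀<l' , l'<top)))
  ...           | no a≢k' = k' , l' , <⇒≤ (<-trans k'<q₀ q₀<top) , <⇒≤ l'<top , ck' ,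
                            relabelled (≤-refl , a<a+m) (≤-trans a≤p₀ (<⇒≤ p₀<q₀) , q₀<top)
                                       (proj₁ (bounds ck') , <-trans k'<q₀ q₀<top) (≤-trans a≤p₀ (<⇒≤ (<-trans p₀<q₀ q₀<l')) , l'<top)
                                       (inj₁ (inj₁ (≤∧≢⇒< (proj₁ (bounds ck')) a≢k' , k'<q₀ , q₀<l')))

  folded-crossing : ∀ {i j k l} → i < j → j < m → k ≤ a + m → l ≤ a + m → Chord B a k l →
                    CrossesU i j (fold k) (fold l) → ∃₂ λ k' l' → Folded k' l' × Crosses i j k' l'
  folded-crossing {i} {j} {k} {l} i<j j<m k≤ l≤ ck crosses with <-cmp (fold k) (fold l)
  ... | tri< k<l _ _ = fold k , fold l , (crossing-is-diag j<m (fold-range≤ l≤) x , k , k≤ , l , l≤ , ck , inj₁ (refl , refl)) , x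
    where x = crossesU-ordered i<j k<l crosses
  ... | tri≈ _ k≡l _ = ⊥-elim (Distinct.v₁≢v₂ (crossesU-distinct crosses) k≡l)
  ... | tri> _ _ l<k = fold l , fold k , (crossing-is-diag j<m (fold-range≤ k≤) x , k , k≤ , l , l≤ , ck , inj₂ (refl , refl)) , x
    where x = crossesU-ordered i<j l<k (crossesU-flipʳ crosses)

  maximal-from : ∀ {p₀ q₀ i j} → a ≤ p₀ → p₀ < q₀ → q₀ < a + m → FoldsTo p₀ q₀ i j → i < j → j < m →
                 ¬ FoldedChord i j → ∃₂ λ k l → Folded k l × Crosses i j k l
  maximal-from {p₀} {q₀} {i} {j} a≤p₀ p₀<q₀ q₀<top o i<j j<m ¬folded with crossing-chord a≤p₀ p₀<q₀ q₀<top ¬c ¬c'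
    where
    ¬c : ¬ Chord B a p₀ q₀
    ¬c c = ¬folded (p₀ , <⇒≤ (<-trans p₀<q₀ q₀<top) , q₀ , <⇒≤ q₀<top , c , o)
    top-folds : FoldsTo a q₀ i j → FoldsTo q₀ (a + m) i j
    top-folds (inj₁ (fa≡i , fq≡j)) = inj₂ (fq≡j , trans fold-+m (trans (sym (fold-below a<m)) fa≡i))
    top-folds (inj₂ (fa≡j , fq≡i)) = inj₁ (fq≡i , trans fold-+m (trans (sym (fold-below a<m)) fa≡j))
    ¬c' : p₀ ≡ a → ¬ Chord B a q₀ (a + m)
    ¬c' refl c = ¬folded (q₀ , <⇒≤ q₀<top , a + m , ≤-refl , c , top-folds o)
  ... | k , l , k≤ , l≤ , ck , cr =
    folded-crossing i<j j<m k≤ l≤ ck (unorientˡ o (from (relabel-crossesU (<⇒≤ (<-trans p₀<q₀ q₀<top)) (<⇒≤ q₀<top) k≤ l≤) cr))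

  folded-maximal : ∀ i j → IsDiag m i j → ¬ Folded i j → ∃₂ λ k l → Folded k l × Crosses i j k l
  folded-maximal i j d ¬folded = by-order (<-cmp (unfold a i) (unfold a j))
    where
    i<j = diag-ordered d
    j<m = proj₁ (proj₂ d)
    i<m = <-trans i<j j<m
    ¬fc : ¬ FoldedChord i j
    ¬fc fc = ¬folded (d , fc)
    inside-i = unfold-inside {a} {i} a<m i<m
    inside-j = unfold-inside {a} {j} a<m j<m
    by-order : Trichotomy (unfold a i < unfold a j) (unfold a i ≡ unfold a j) (unfold a j < unfold a i) →
               ∃₂ λ k l → Folded k l × Crosses i j k l
    by-order (tri< I<J _ _) = maximal-from (proj₁ inside-i) I<J (proj₂ inside-j) (inj₁ (fold-unfold i<m , fold-unfold j<m)) i<j j<m ¬fc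
    by-order (tri≈ _ I≡J _) = ⊥-elim (<-irrefl (trans (sym (fold-unfold i<m)) (trans (cong fold I≡J) (fold-unfold j<m))) i<j)
    by-order (tri> _ _ J<I) = maximal-from (proj₁ inside-j) J<I (proj₂ inside-i) (inj₂ (fold-unfold j<m , fold-unfold i<m)) i<j j<m ¬fc

  folded-triangulation : Triangulation m Folded
  folded-triangulation = record
    { diagonal = proj₁ ; noncrossing = folded-noncrossing ; maximal = folded-maximal ; decide = folded? }

module Rotation (m : ℕ) {{_ : NonZero m}} where

  rotate : ℕ → ℕ → ℕ
  rotate s u = (u + s) % m

  rotate<m : ∀ s u → rotate s u < m
  rotate<m s u = m%n<n (u + s) m

  rotatesBy⇒≡ : ∀ {s u x} → RotatesBy m s u x → x < m → x ≡ rotate s u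
  rotatesBy⇒≡ (inj₁ refl) x<m = sym (m<n⇒m%n≡m x<m)
  rotatesBy⇒≡ {s} {u} {x} (inj₂ u+s≡x+m) x<m = sym (trans (cong (_% m) u+s≡x+m) (trans ([m+n]%n≡m%n x m) (m<n⇒m%n≡m x<m)))

  rotatesBy-rotate : ∀ {s u} → u < m → s ≤ m → RotatesBy m s u (rotate s u)
  rotatesBy-rotate {s} {u} u<m s≤m with u + s <? m
  ... | yes u+s<m = inj₁ (sym (m<n⇒m%n≡m u+s<m))
  ... | no u+s≮m = inj₂ (trans (sym w+m≡) (cong (_+ m) (sym rotate≡w)))
    where
    w = u + s ∸ m
    w+m≡ : w + m ≡ u + s
    w+m≡ = m∸n+n≡m (≮⇒≥ u+s≮m)
    rotate≡w : rotate s u ≡ w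
    rotate≡w = trans (cong (_% m) (sym w+m≡)) (trans ([m+n]%n≡m%n w m)
                 (m<n⇒m%n≡m (+-cancelʳ-< m w m (subst (_< m + m) (sym w+m≡) (+-mono-<-≤ u<m s≤m)))))

  rotatesBy-unique : ∀ {s u x y} → RotatesBy m s u x → RotatesBy m s u y → x < m → y < m → x ≡ y
  rotatesBy-unique {s} {u} rx ry x<m y<m = trans (rotatesBy⇒≡ {s} {u} rx x<m) (sym (rotatesBy⇒≡ {s} {u} ry y<m))

  rotate-rotate : ∀ s₁ s₂ u → rotate s₂ (rotate s₁ u) ≡ rotate (s₁ + s₂) u
  rotate-rotate s₁ s₂ u = begin
    ((u + s₁) % m + s₂) % m         ≡⟨ %-distribˡ-+ ((u + s₁) % m) s₂ m ⟩
    ((u + s₁) % m % m + s₂ % m) % m ≡⟨ cong (λ z → (z + s₂ % m) % m) (m%n%n≡m%n (u + s₁) m) ⟩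
    ((u + s₁) % m + s₂ % m) % m     ≡⟨ %-distribˡ-+ (u + s₁) s₂ m ⟨
    (u + s₁ + s₂) % m               ≡⟨ cong (_% m) (+-assoc u s₁ s₂) ⟩
    (u + (s₁ + s₂)) % m             ∎
    where open ≡-Reasoning

  rotate-full : ∀ {u} → u < m → rotate m u ≡ u
  rotate-full {u} u<m = trans ([m+n]%n≡m%n u m) (m<n⇒m%n≡m u<m)

-- The symmetric triangulation built from a tree t of width n and a vertex a < n:
-- three copies of the triangulation t of an (n + 1)-gon, placed on the arcs starting
-- at a , a + n , a + 2n, together with the central triangle (a , a + n , a + 2n).
-- Technically it is the fold of the tree B = node (node t t) t placed at a.
module Construction (n : ℕ) (n≥1 : 1 ≤ n) (t : Tree) (width-t : width t ≡ n) (a : ℕ) (a<n : a < n) where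

  m : ℕ
  m = 3 * n

  abstract
    m≡n+n+n : m ≡ n + n + n
    m≡n+n+n = three n
      where
      three : ∀ n → 3 * n ≡ n + n + n
      three = solve-∀

  instance
    m≢0 : NonZero m
    m≢0 = >-nonZero (≤-trans n≥1 (m≤m+n n (2 * n)))

  B : Tree
  B = node (node t t) t

  abstract
    width-B : width B ≡ m
    width-B = trans (cong₂ (λ x y → x + y + x) width-t width-t) (sym m≡n+n+n)

  abstract
    n<m : n < m
    n<m = subst (n <_) (sym m≡n+n+n) (<-≤-trans (m<m+n n n≥1) (m≤m+n (n + n) n))

  abstract
    a<m : a < m
    a<m = <-trans a<n n<m

  abstract
    a+n<m : a + n < m
    a+n<m = <-≤-trans (+-monoˡ-< n a<n) (subst (n + n ≤_) (sym m≡n+n+n) (m≤m+n (n + n) n))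

  open Folding m B width-B a a<m public
  open Rotation m

  offset : ℕ → ℕ
  offset r = a + r * n

  abstract
    offset-suc : ∀ r → offset (suc r) ≡ n + offset r
    offset-suc r = shuffle a r n
      where
      shuffle : ∀ a r n → a + (n + r * n) ≡ n + (a + r * n)
      shuffle = solve-∀

  abstract
    offset-wrap : n + offset 2 ≡ m + offset 0
    offset-wrap = shuffle a n
      where
      shuffle : ∀ a n → n + (a + 2 * n) ≡ 3 * n + (a + 0 * n)
      shuffle = solve-∀

  abstract
    offset-0 : offset 0 ≡ a
    offset-0 = +-identityʳ a

  abstract
    offset-1 : offset 1 ≡ a + width t
    offset-1 = cong (a +_) (trans (+-identityʳ n) (sym width-t))

  abstract
    offset-2 : offset 2 ≡ a + (width t + width t)
    offset-2 = cong (a +_) (trans (cong (n +_) (+-identityʳ n)) (sym (cong₂ _+_ width-t width-t)))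

  copy-in-B : ∀ r → r < 3 → Chord t (offset r) ⊆ᶜ Chord B a
  copy-in-B 0 _ {p} {q} c = inj₂ (inj₁ (inj₂ (inj₁ (subst (λ z → Chord t z p q) offset-0 c))))
  copy-in-B 1 _ {p} {q} c = inj₂ (inj₁ (inj₂ (inj₂ (subst (λ z → Chord t z p q) offset-1 c))))
  copy-in-B 2 _ {p} {q} c = inj₂ (inj₂ (subst (λ z → Chord t z p q) offset-2 c))
  copy-in-B (suc (suc (suc _))) (s≤s (s≤s (s≤s ())))

  copy-bounds : ∀ r → r < 3 → ∀ {p q} → Chord t (offset r) p q → p ≤ a + m × q ≤ a + m
  copy-bounds r r<3 c with bounds (copy-in-B r r<3 c)
  ... | _ , p<q , q≤ = <⇒≤ (<-≤-trans p<q q≤) , q≤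

  copy-short : ∀ r {p q} → Chord t (offset r) p q → q ≤ p + n
  copy-short r c with chord-bounds c
  ... | offset≤p , _ , q≤ = ≤-trans (subst (λ w → _ ≤ offset r + w) width-t q≤) (+-monoˡ-≤ n offset≤p)

  CopySegment : ℕ → ℕ → Set
  CopySegment i j = ∃ λ r → r < 3 × ∃₂ λ p q → Chord t (offset r) p q × suc p < q × FoldsTo p q i j

  copy-flip : ∀ {i j} → CopySegment i j → CopySegment j i
  copy-flip (r , r<3 , p , q , c , p+1<q , inj₁ (fp , fq)) = r , r<3 , p , q , c , p+1<q , inj₂ (fp , fq)
  copy-flip (r , r<3 , p , q , c , p+1<q , inj₂ (fp , fq)) = r , r<3 , p , q , c , p+1<q , inj₁ (fp , fq)

  below-or-above : ∀ p → p < m ⊎ ∃ λ w → p ≡ w + m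
  below-or-above p with p <? m
  ... | yes p<m = inj₁ p<m
  ... | no p≮m = inj₂ (p ∸ m , sym (m∸n+n≡m (≮⇒≥ p≮m)))

  HasDiag : ℕ → ℕ → Set
  HasDiag i j = IsDiag m i j ⊎ IsDiag m j i

  not-0-and-last : ∀ x y → suc y < x + m → 0 < x ⊎ suc y < m
  not-0-and-last zero y y+1<m = inj₂ y+1<m
  not-0-and-last (suc x) y _ = inj₁ (s≤s z≤n)

  short-fold-diagonal : ∀ {p q} → suc p < q → suc q < p + m → q < m + m → HasDiag (fold p) (fold q)
  short-fold-diagonal {p} {q} p+1<q q+1<p+m q<2m with below-or-above p | below-or-above q
  ... | inj₁ p<m | inj₁ q<m rewrite fold-below p<m | fold-below q<m =
        inj₁ (p+1<q , q<m , not-0-and-last p q q+1<p+m)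
  ... | inj₁ p<m | inj₂ (w , refl) rewrite fold-below p<m | fold-+m {w} =
        inj₂ (+-cancelʳ-< m (suc w) p q+1<p+m , p<m , not-0-and-last w p p+1<q)
  ... | inj₂ (w , refl) | inj₁ q<m = ⊥-elim (<-asym (<-≤-trans q<m (m≤n+m m w)) (<-trans (n<1+n _) p+1<q))
  ... | inj₂ (w , refl) | inj₂ (v , refl) rewrite fold-+m {w} | fold-+m {v} =
        inj₁ (+-cancelʳ-< m (suc w) v p+1<q , +-cancelʳ-< m v m q<2m ,
              not-0-and-last w v (+-cancelʳ-< m (suc v) (w + m) q+1<p+m))

  foldsTo-segment : ∀ {R : ℕ → ℕ → Set} {p q i j} → FoldsTo p q i j → HasSegment R (fold p) (fold q) → HasSegment R i j
  foldsTo-segment (inj₁ (refl , refl)) h = h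
  foldsTo-segment {R} (inj₂ (refl , refl)) h = segment-sym {R} h

  abstract
    n+1<m : suc n < m
    n+1<m = subst (suc n <_) (sym m≡n+n+n) (+-mono-≤ (+-mono-≤ n≥1 n≥1) (≤-refl {n}))

  short : ∀ {p q} → q ≤ p + n → suc q < p + m
  short {p} q≤p+n = ≤-<-trans (s≤s q≤p+n) (subst (_< p + m) (+-suc p n) (+-monoʳ-< p n+1<m))

  copy⇒folded : ∀ {i j} → CopySegment i j → HasSegment Folded i j
  copy⇒folded (r , r<3 , p , q , c , p+1<q , o) with copy-bounds r r<3 c
  ... | p≤ , q≤ with short-fold-diagonal p+1<q (short (copy-short r c)) (≤-<-trans q≤ a+m<2m)
  ...   | inj₁ d = foldsTo-segment {Folded} o (inj₁ (d , p , p≤ , q , q≤ , copy-in-B r r<3 c , inj₁ (refl , refl)))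
  ...   | inj₂ d = foldsTo-segment {Folded} o (inj₂ (d , p , p≤ , q , q≤ , copy-in-B r r<3 c , inj₂ (refl , refl)))

  side-not-diagonal : ∀ {p i j} → suc p < m + m → FoldsTo p (suc p) i j → ¬ IsDiag m i j
  side-not-diagonal {p} p+1<2m o d with fold-suc p+1<2m | o
  ... | inj₁ next | inj₁ (refl , refl) = <-irrefl next (proj₁ d)
  ... | inj₁ next | inj₂ (refl , refl) = <-asym (subst (fold p <_) next ≤-refl) (diag-ordered d)
  ... | inj₂ (last , wrap) | inj₁ (refl , refl) = <-irrefl (sym wrap) (≤-<-trans z≤n (diag-ordered d))
  ... | inj₂ (last , wrap) | inj₂ (refl , refl) with proj₂ (proj₂ d)
  ...   | inj₁ 0<i = <-irrefl (sym wrap) 0<i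
  ...   | inj₂ j+1<m = <-irrefl last j+1<m

  copy-segment : ∀ r → r < 3 → ∀ {p q i j} → Chord t (offset r) p q → FoldsTo p q i j → IsDiag m i j → CopySegment i j
  copy-segment r r<3 {p} {q} c o d with suc p ≟ q
  ... | yes refl = ⊥-elim (side-not-diagonal (≤-<-trans (proj₂ (copy-bounds r r<3 c)) a+m<2m) o d)
  ... | no p+1≢q = r , r<3 , p , q , c , ≤∧≢⇒< (proj₁ (proj₂ (chord-bounds c))) p+1≢q , o

  n≥2 : IsDiag m a (a + 2 * n) → 2 ≤ n
  n≥2 (_ , _ , inj₁ 0<a) = ≤-trans (s≤s 0<a) a<n
  n≥2 (_ , _ , inj₂ a+2n+1<m) =
    +-cancelˡ-≤ (2 * n) 2 n (subst (_≤ 2 * n + n) (+-comm 2 (2 * n))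
      (≤-trans (+-monoʳ-≤ 2 (m≤n+m (2 * n) a)) (subst (suc (a + 2 * n) <_) (three n) a+2n+1<m)))
    where
    three : ∀ n → 3 * n ≡ 2 * n + n
    three = solve-∀

  abstract
    top≡ : offset 2 + width t ≡ a + m
    top≡ = trans (cong (offset 2 +_) width-t) (shuffle a n)
      where
      shuffle : ∀ a n → a + 2 * n + n ≡ a + 3 * n
      shuffle = solve-∀

  abstract
    a+2n<m : a + 2 * n < m
    a+2n<m = subst (a + 2 * n <_) (three n) (+-monoˡ-< (2 * n) a<n)
      where
      three : ∀ n → n + 2 * n ≡ 3 * n
      three = solve-∀

  -- The chord (a , a + 2n) of B folds like the root chord of the third copy.
  middle-chord : ∀ {i j} → IsDiag m i j → FoldsTo a (a + (width t + width t)) i j → CopySegment i j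
  middle-chord {i} {j} d (inj₂ (fa≡j , fQ≡i)) =
    ⊥-elim (<-asym (diag-ordered d) (subst₂ _<_ (trans (sym (fold-below a<m)) fa≡j) (trans (trans (sym (fold-below a+2n<m)) (cong fold offset-2)) fQ≡i)
                                          (m<m+n a (≤-trans (s≤s z≤n) (*-monoʳ-≤ 2 n≥1)))))
  middle-chord {i} {j} d (inj₁ (fa≡i , fQ≡j)) =
    2 , s≤s (s≤s (s≤s z≤n)) , offset 2 , offset 2 + width t , inj₁ (refl , refl) , long ,
    inj₂ (trans (cong fold offset-2) fQ≡j , trans (cong fold top≡) (trans fold-+m (trans (sym (fold-below a<m)) fa≡i)))
    where
    i≡a : i ≡ a
    i≡a = trans (sym fa≡i) (fold-below a<m)
    j≡ : j ≡ a + 2 * n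
    j≡ = trans (sym fQ≡j) (trans (cong fold (sym offset-2)) (fold-below a+2n<m))
    long : suc (offset 2) < offset 2 + width t
    long = subst₂ _≤_ (+-comm (offset 2) 2) refl (+-monoʳ-≤ (offset 2) (subst (2 ≤_) (sym width-t) (n≥2 (subst₂ (IsDiag m) i≡a j≡ d))))

  folded⇒copy : ∀ {i j} → Folded i j → CopySegment i j
  folded⇒copy {i} {j} (d , _ , _ , _ , _ , inj₁ (refl , refl) , o) = ⊥-elim (<-irrefl (root-point o) (diag-ordered d))
    where
    root-point : FoldsTo a (a + width B) i j → i ≡ j
    root-point (inj₁ (fa≡i , fe≡j)) = trans (sym fa≡i) (trans (fold-below a<m) (trans (sym fold-+m) (trans (cong (λ w → fold (a + w)) (sym width-B)) fe≡j)))
    root-point (inj₂ (fa≡j , fe≡i)) = trans (sym fe≡i) (trans (cong (λ w → fold (a + w)) width-B) (trans fold-+m (trans (sym (fold-below a<m)) fa≡j)))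
  folded⇒copy (d , _ , _ , _ , _ , inj₂ (inj₁ (inj₁ (refl , refl))) , o) = middle-chord d o
  folded⇒copy (d , p , _ , q , _ , inj₂ (inj₁ (inj₂ (inj₁ c))) , o) =
    copy-segment 0 (s≤s z≤n) (subst (λ z → Chord t z p q) (sym offset-0) c) o d
  folded⇒copy (d , p , _ , q , _ , inj₂ (inj₁ (inj₂ (inj₂ c))) , o) =
    copy-segment 1 (s≤s (s≤s z≤n)) (subst (λ z → Chord t z p q) (sym offset-1) c) o d
  folded⇒copy (d , p , _ , q , _ , inj₂ (inj₂ c) , o) =
    copy-segment 2 (s≤s (s≤s (s≤s z≤n))) (subst (λ z → Chord t z p q) (sym offset-2) c) o d

-- The constructed triangulation is invariant under the rotations by n and 2n steps:
-- the rotation by n carries each copy of t onto the next one.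
module Symmetry (n : ℕ) (n≥1 : 1 ≤ n) (t : Tree) (width-t : width t ≡ n) (a : ℕ) (a<n : a < n) where
  open Construction n n≥1 t width-t a a<n
  open Rotation m

  abstract
    n≤m : n ≤ m
    n≤m = <⇒≤ n<m

  fold-rotate : ∀ p → RotatesBy m n (fold p) (fold (n + p))
  fold-rotate p with below-or-above p | below-or-above (n + p)
  ... | inj₁ p<m | inj₁ n+p<m rewrite fold-below p<m | fold-below n+p<m = inj₁ (+-comm p n)
  ... | inj₁ p<m | inj₂ (v , n+p≡v+m) rewrite fold-below p<m =
        inj₂ (trans (+-comm p n) (trans n+p≡v+m (cong (_+ m) (sym (trans (cong fold n+p≡v+m) (fold-+m {v}))))))
  ... | inj₂ (w , refl) | inj₁ n+p<m = ⊥-elim (<⇒≱ n+p<m (≤-trans (m≤n+m m w) (m≤n+m (w + m) n)))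
  ... | inj₂ (w , refl) | inj₂ (v , n+p≡v+m) rewrite fold-+m {w} =
        inj₁ (trans (+-comm w n) (trans (+-cancelʳ-≡ m (n + w) v (trans (+-assoc n w m) n+p≡v+m))
                                        (sym (trans (cong fold n+p≡v+m) (fold-+m {v})))))

  foldsTo-rotate : ∀ {p q i j i' j'} → FoldsTo p q i j → RotatesBy m n i i' → RotatesBy m n j j' → i' < m → j' < m →
                   n + p < m + m → n + q < m + m → FoldsTo (n + p) (n + q) i' j'
  foldsTo-rotate {p} {q} (inj₁ (refl , refl)) ri rj i'<m j'<m np<2m nq<2m =
    inj₁ (rotatesBy-unique {n} {fold p} (fold-rotate p) ri (fold-range np<2m) i'<m , rotatesBy-unique {n} {fold q} (fold-rotate q) rj (fold-range nq<2m) j'<m)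
  foldsTo-rotate {p} {q} (inj₂ (refl , refl)) ri rj i'<m j'<m np<2m nq<2m =
    inj₂ (rotatesBy-unique {n} {fold p} (fold-rotate p) rj (fold-range np<2m) j'<m , rotatesBy-unique {n} {fold q} (fold-rotate q) ri (fold-range nq<2m) i'<m)

  foldsTo-cong : ∀ {p q p' q' i j} → fold p' ≡ fold p → fold q' ≡ fold q → FoldsTo p q i j → FoldsTo p' q' i j
  foldsTo-cong e₁ e₂ (inj₁ (fp , fq)) = inj₁ (trans e₁ fp , trans e₂ fq)
  foldsTo-cong e₁ e₂ (inj₂ (fp , fq)) = inj₂ (trans e₁ fp , trans e₂ fq)

  abstract
    n+top<2m : n + (a + m) < m + m
    n+top<2m = subst (_< m + m) (+-assoc n a m) (+-monoˡ-< m (subst (_< m) (+-comm a n) a+n<m))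

  -- the rotation by n of a non-side chord of copy r is (up to m) a chord of copy r + 1 mod 3
  RotatedChord : ℕ → ℕ → Set
  RotatedChord p q = ∃ λ r → r < 3 × ∃₂ λ p' q' → Chord t (offset r) p' q' × suc p' < q' ×
                                                   fold p' ≡ fold (n + p) × fold q' ≡ fold (n + q)

  shifted-longer : ∀ {p q} → suc p < q → suc (n + p) < n + q
  shifted-longer {p} {q} p+1<q = subst (_< n + q) (+-suc n p) (+-monoʳ-< n p+1<q)

  rotate-copy-chord : ∀ r → r < 3 → ∀ {p q} → Chord t (offset r) p q → suc p < q → RotatedChord p q
  rotate-copy-chord 0 _ {p} {q} c p+1<q =
    1 , s≤s (s≤s z≤n) , n + p , n + q , subst (λ z → Chord t z (n + p) (n + q)) (sym (offset-suc 0)) (chord-shift t (offset 0) n c) ,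
    shifted-longer p+1<q , refl , refl
  rotate-copy-chord 1 _ {p} {q} c p+1<q =
    2 , s≤s (s≤s (s≤s z≤n)) , n + p , n + q , subst (λ z → Chord t z (n + p) (n + q)) (sym (offset-suc 1)) (chord-shift t (offset 1) n c) ,
    shifted-longer p+1<q , refl , refl
  rotate-copy-chord 2 r<3 {p} {q} c p+1<q = 0 , s≤s z≤n , p' , q' , unwrapped , p'+1<q' , fold-p' , fold-q'
    where
    m≤n+p : m ≤ n + p
    m≤n+p = ≤-trans (≤-reflexive (three n)) (+-monoʳ-≤ n (≤-trans (m≤n+m (2 * n) a) (proj₁ (chord-bounds c))))
      where
      three : ∀ n → 3 * n ≡ n + 2 * n
      three = solve-∀
    p' = n + p ∸ m
    q' = n + q ∸ m
    p'+m : p' + m ≡ n + p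
    p'+m = m∸n+n≡m m≤n+p
    q'+m : q' + m ≡ n + q
    q'+m = m∸n+n≡m (≤-trans m≤n+p (+-monoʳ-≤ n (<⇒≤ (<-trans (n<1+n p) p+1<q))))
    unwrapped : Chord t (offset 0) p' q'
    unwrapped = chord-unshift t (offset 0) m
      (subst (λ z → Chord t (m + offset 0) z (m + q')) (trans (sym p'+m) (+-comm p' m))
        (subst (λ z → Chord t (m + offset 0) (n + p) z) (trans (sym q'+m) (+-comm q' m))
          (subst (λ z → Chord t z (n + p) (n + q)) offset-wrap (chord-shift t (offset 2) n c))))
    p'+1<q' : suc p' < q'
    p'+1<q' = +-cancelʳ-< m (suc p') q' (subst₂ (λ x y → suc x < y) (sym p'+m) (sym q'+m) (shifted-longer p+1<q))
    fold-p' : fold p' ≡ fold (n + p)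
    fold-p' = trans (fold-below (+-cancelʳ-< m p' m (subst (_< m + m) (sym p'+m)
                      (≤-<-trans (+-monoʳ-≤ n (proj₁ (copy-bounds 2 r<3 c))) n+top<2m))))
                    (trans (sym fold-+m) (cong fold p'+m))
    fold-q' : fold q' ≡ fold (n + q)
    fold-q' = trans (fold-below (+-cancelʳ-< m q' m (subst (_< m + m) (sym q'+m)
                      (≤-<-trans (+-monoʳ-≤ n (proj₂ (copy-bounds 2 r<3 c))) n+top<2m))))
                    (trans (sym fold-+m) (cong fold q'+m))
  rotate-copy-chord (suc (suc (suc _))) (s≤s (s≤s (s≤s ())))

  copy-rotate : ∀ {i j i' j'} → CopySegment i j → RotatesBy m n i i' → RotatesBy m n j j' → i' < m → j' < m → CopySegment i' j'
  copy-rotate (r , r<3 , p , q , c , p+1<q , o) ri rj i'<m j'<m with rotate-copy-chord r r<3 c p+1<q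
  ... | r' , r'<3 , p' , q' , c' , p'+1<q' , fold-p' , fold-q' =
        r' , r'<3 , p' , q' , c' , p'+1<q' , foldsTo-cong fold-p' fold-q' (foldsTo-rotate o ri rj i'<m j'<m
          (≤-<-trans (+-monoʳ-≤ n (proj₁ (copy-bounds r r<3 c))) n+top<2m)
          (≤-<-trans (+-monoʳ-≤ n (proj₂ (copy-bounds r r<3 c))) n+top<2m))

  rotateₙ : ℕ → ℕ
  rotateₙ = rotate n

  copy-rotateₙ : ∀ {i j} → i < m → j < m → CopySegment i j → CopySegment (rotateₙ i) (rotateₙ j)
  copy-rotateₙ i<m j<m cs = copy-rotate cs (rotatesBy-rotate i<m n≤m) (rotatesBy-rotate j<m n≤m) (rotate<m n _) (rotate<m n _)

  copy-rotateₙ² : ∀ {i j} → i < m → j < m → CopySegment i j → CopySegment (rotateₙ (rotateₙ i)) (rotateₙ (rotateₙ j))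
  copy-rotateₙ² i<m j<m cs = copy-rotateₙ (rotate<m n _) (rotate<m n _) (copy-rotateₙ i<m j<m cs)

  rotateₙ³ : ∀ {u} → u < m → rotateₙ (rotateₙ (rotateₙ u)) ≡ u
  rotateₙ³ {u} u<m = begin
    rotate n (rotate n (rotate n u)) ≡⟨ rotate-rotate n n (rotate n u) ⟩
    rotate (n + n) (rotate n u)      ≡⟨ rotate-rotate n (n + n) u ⟩
    rotate (n + (n + n)) u           ≡⟨ cong (λ s → rotate s u) (trans (sym (+-assoc n n n)) (sym m≡n+n+n)) ⟩
    rotate m u                       ≡⟨ rotate-full u<m ⟩
    u                                ∎
    where open ≡-Reasoning

  segment⇒copy : ∀ {i j} → HasSegment Folded i j → CopySegment i j
  segment⇒copy (inj₁ f) = folded⇒copy f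
  segment⇒copy (inj₂ f) = copy-flip (folded⇒copy f)

  invariant-by : ∀ s (ρ σ : ℕ → ℕ) → (∀ {u} → u < m → rotate s u ≡ ρ u) → (∀ {u} → u < m → σ (ρ u) ≡ u) →
    (∀ {i j} → i < m → j < m → CopySegment i j → CopySegment (ρ i) (ρ j)) →
    (∀ {i j} → i < m → j < m → CopySegment i j → CopySegment (σ i) (σ j)) → Invariant m s Folded
  invariant-by s ρ σ rotate≡ρ σρ ρ-closed σ-closed i j i' j' i<m j<m i'<m j'<m ri rj = mk⇔ forward backward
    where
    i'≡ρi : i' ≡ ρ i
    i'≡ρi = trans (rotatesBy⇒≡ {s} {i} ri i'<m) (rotate≡ρ i<m)
    j'≡ρj : j' ≡ ρ j
    j'≡ρj = trans (rotatesBy⇒≡ {s} {j} rj j'<m) (rotate≡ρ j<m)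
    forward : HasSegment Folded i j → HasSegment Folded i' j'
    forward h = copy⇒folded (subst₂ CopySegment (sym i'≡ρi) (sym j'≡ρj) (ρ-closed i<m j<m (segment⇒copy h)))
    backward : HasSegment Folded i' j' → HasSegment Folded i j
    backward h = copy⇒folded (subst₂ CopySegment (trans (cong σ i'≡ρi) (σρ i<m)) (trans (cong σ j'≡ρj) (σρ j<m))
                                                 (σ-closed i'<m j'<m (segment⇒copy h)))

  folded-invariant-n : Invariant m n Folded
  folded-invariant-n = invariant-by n rotateₙ (λ u → rotateₙ (rotateₙ u)) (λ _ → refl) rotateₙ³ copy-rotateₙ copy-rotateₙ²

  folded-invariant-2n : Invariant m (2 * n) Folded
  folded-invariant-2n = invariant-by (2 * n) (λ u → rotateₙ (rotateₙ u)) rotateₙ rotate-2n rotateₙ³ copy-rotateₙ² copy-rotateₙ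
    where
    rotate-2n : ∀ {u} → u < m → rotate (2 * n) u ≡ rotateₙ (rotateₙ u)
    rotate-2n {u} _ = trans (cong (λ s → rotate s u) (cong (n +_) (+-identityʳ n))) (sym (rotate-rotate n n u))

module FirstCopy (n : ℕ) (n≥1 : 1 ≤ n) (t : Tree) (width-t : width t ≡ n) (a : ℕ) (a<n : a < n) where
  open Construction n n≥1 t width-t a a<n

  first-copy-bounds : ∀ {i j} → Chord t a i j → a ≤ i × i < j × j ≤ a + n
  first-copy-bounds c with chord-bounds c
  ... | a≤i , i<j , j≤ = a≤i , i<j , subst (λ w → _ ≤ a + w) width-t j≤

  abstract
    a+n+1<m : suc (a + n) < m
    a+n+1<m = ≤-trans (s≤s (+-monoˡ-≤ n a<n)) (subst (suc n + n ≤_) (sym m≡n+n+n) (+-monoˡ-≤ n (+-monoˡ-≤ n n≥1)))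

  first-copy-edge : ∀ {i j} → Chord t a i j → Edge m Folded i j
  first-copy-edge {i} {j} c with first-copy-bounds c | suc i ≟ j
  ... | _ | yes i+1≡j = inj₁ i+1≡j
  ... | a≤i , i<j , j≤a+n | no i+1≢j = inj₂ (inj₂ (diagonal , i , i≤top , j , j≤top , copy , inj₁ (fold-below i<m , fold-below j<m)))
    where
    j<m = ≤-<-trans j≤a+n a+n<m
    i<m = <-trans i<j j<m
    i≤top = ≤-trans (<⇒≤ i<m) (m≤n+m m a)
    j≤top = ≤-trans (<⇒≤ j<m) (m≤n+m m a)
    copy = copy-in-B 0 (s≤s z≤n) (subst (λ z → Chord t z i j) (sym offset-0) c)
    diagonal : IsDiag m i j
    diagonal = ≤∧≢⇒< i<j i+1≢j , j<m , inj₂ (≤-<-trans (s≤s j≤a+n) a+n+1<m)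

  root-chord : Chord t a a (a + n)
  root-chord = inj₁ (refl , cong (a +_) (sym width-t))

  folded-root : 2 ≤ n → Folded a (a + n)
  folded-root n≥2 = diag-not-side {M = Folded} diagonal (first-copy-edge root-chord)
    where
    diagonal : IsDiag m a (a + n)
    diagonal = subst (_≤ a + n) (+-comm a 2) (+-monoʳ-≤ a n≥2) , a+n<m , inj₂ a+n+1<m

-- Every triangulation of the 3n-gon invariant under the rotations by n and 2n is the
-- construction for some tree t and some a < n: a is read off the central triangle and
-- t is the triangulation of the arc a , ... , a + n cut off by its side (a , a + n).
module Completeness (n : ℕ) (n≥1 : 1 ≤ n) {M : ℕ → ℕ → Set} (T : Triangulation (3 * n) M)
                    (invariant-n : Invariant (3 * n) n M) (invariant-2n : Invariant (3 * n) (2 * n) M) where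
  open Triangulation T
  open TriangulationProperties T
  open CentralTriangle n n≥1 T invariant-n using (central)

  abstract
    a : ℕ
    a = proj₁ central

    a+2n<m : a + 2 * n < 3 * n
    a+2n<m = proj₁ (proj₂ central)

    side-a : Edge (3 * n) M a (a + n)
    side-a = proj₂ (proj₂ central)

  abstract
    a<n : a < n
    a<n = +-cancelʳ-< (2 * n) a n (subst (a + 2 * n <_) (three n) a+2n<m)
      where
      three : ∀ n → 3 * n ≡ n + 2 * n
      three = solve-∀

  abstract
    a+n<3n : a + n < 3 * n
    a+n<3n = ≤-<-trans (+-monoʳ-≤ a (m≤m+n n (n + 0))) a+2n<m

  open TreeFromTriangles (Edge (3 * n) M) a (a + n) (λ _ j≤a+n eij i+1<j → apex i+1<j (≤-<-trans j≤a+n a+n<3n) eij)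

  abstract
    arc : SpanningTree a (a + n)
    arc = spanning-tree (m<m+n a n≥1) ≤-refl ≤-refl side-a

    t : Tree
    t = proj₁ arc

    width-t : width t ≡ n
    width-t = +-cancelˡ-≡ a (width t) n (proj₁ (proj₂ arc))

    t⊆edges : Chord t a ⊆ᶜ Edge (3 * n) M
    t⊆edges = proj₂ (proj₂ arc)

  open Construction n n≥1 t width-t a a<n
  open FirstCopy n n≥1 t width-t a a<n
  open Rotation m

  CyclicEdge : ℕ → ℕ → Set
  CyclicEdge u v = HasSegment M u v ⊎ (rotate 1 u ≡ v ⊎ rotate 1 v ≡ u)

  cyclicEdge-sym : ∀ {u v} → CyclicEdge u v → CyclicEdge v u
  cyclicEdge-sym (inj₁ h) = inj₁ (segment-sym {M} h)
  cyclicEdge-sym (inj₂ (inj₁ e)) = inj₂ (inj₂ e)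
  cyclicEdge-sym (inj₂ (inj₂ e)) = inj₂ (inj₁ e)

  edge⇒cyclic : ∀ {x y} → y < m → Edge m M x y → CyclicEdge x y
  edge⇒cyclic {x} y<m (inj₁ refl) = inj₂ (inj₁ (trans (cong (_% m) (+-comm x 1)) (m<n⇒m%n≡m y<m)))
  edge⇒cyclic {y = y} _ (inj₂ (inj₁ (refl , y+1≡m))) = inj₂ (inj₂ (trans (cong (_% m) (trans (+-comm y 1) y+1≡m)) (n%n≡0 m)))
  edge⇒cyclic _ (inj₂ (inj₂ mxy)) = inj₁ (inj₁ mxy)

  cyclic⇒M : ∀ {i j} → IsDiag m i j → CyclicEdge i j → M i j
  cyclic⇒M d (inj₁ h) = oriented h (diag-ordered d)
  cyclic⇒M {i} d (inj₂ (inj₁ next)) =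
    ⊥-elim (<-irrefl (trans (sym (m<n⇒m%n≡m (<-trans (proj₁ d) (proj₁ (proj₂ d))))) (trans (cong (_% m) (+-comm 1 i)) next)) (proj₁ d))
  cyclic⇒M {i} {j} d (inj₂ (inj₂ next)) with suc j <? m
  ... | yes j+1<m = ⊥-elim (<-asym (diag-ordered d)
                      (subst (j <_) (trans (sym (m<n⇒m%n≡m j+1<m)) (trans (cong (_% m) (+-comm 1 j)) next)) (n<1+n j)))
  ... | no j+1≮m = diag-not-side {M = M} d (inj₂ (inj₁ (i≡0 , j+1≡m)))
    where
    j+1≡m = ≤-antisym (proj₁ (proj₂ d)) (≮⇒≥ j+1≮m)
    i≡0 = trans (sym next) (trans (cong (_% m) (trans (+-comm j 1) j+1≡m)) (n%n≡0 m))

  cyclicEdge-rotate : ∀ s → Invariant m s M → ∀ {u v u' v'} → u < m → v < m → u' < m → v' < m →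
                      RotatesBy m s u u' → RotatesBy m s v v' → CyclicEdge u v → CyclicEdge u' v'
  cyclicEdge-rotate s inv u<m v<m u'<m v'<m ru rv (inj₁ h) = inj₁ (to (inv _ _ _ _ u<m v<m u'<m v'<m ru rv) h)
  cyclicEdge-rotate s inv {u} {v} {u'} {v'} u<m v<m u'<m v'<m ru rv (inj₂ (inj₁ next)) = inj₂ (inj₁ (next-rotates ru rv u'<m v'<m next))
    where
    next-rotates : ∀ {u v u' v'} → RotatesBy m s u u' → RotatesBy m s v v' → u' < m → v' < m → rotate 1 u ≡ v → rotate 1 u' ≡ v'
    next-rotates {u} {v} {u'} {v'} ru rv u'<m v'<m next = begin
      rotate 1 u'        ≡⟨ cong (rotate 1) (rotatesBy⇒≡ {s} {u} ru u'<m) ⟩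
      rotate 1 (rotate s u) ≡⟨ rotate-rotate s 1 u ⟩
      rotate (s + 1) u   ≡⟨ cong (λ k → rotate k u) (+-comm s 1) ⟩
      rotate (1 + s) u   ≡⟨ rotate-rotate 1 s u ⟨
      rotate s (rotate 1 u) ≡⟨ cong (rotate s) next ⟩
      rotate s v         ≡⟨ rotatesBy⇒≡ {s} {v} rv v'<m ⟨
      v'                 ∎
      where open ≡-Reasoning
  cyclicEdge-rotate s inv u<m v<m u'<m v'<m ru rv (inj₂ (inj₂ next)) =
    cyclicEdge-sym (cyclicEdge-rotate s inv v<m u<m v'<m u'<m rv ru (inj₂ (inj₁ next)))

  rotatesBy-fold : ∀ s u → u + s < m + m → RotatesBy m s u (fold (u + s))
  rotatesBy-fold s u u+s<2m with below-or-above (u + s)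
  ... | inj₁ u+s<m = inj₁ (sym (fold-below u+s<m))
  ... | inj₂ (w , u+s≡w+m) = inj₂ (trans u+s≡w+m (cong (_+ m) (sym (trans (cong fold u+s≡w+m) (fold-+m {w})))))

  copy-by : ∀ s → Invariant m s M → ∀ {p q} → Chord t (a + s) p q → p ≤ a + m → q ≤ a + m → CyclicEdge (fold p) (fold q)
  copy-by s inv {p} {q} c p≤ q≤ =
    subst₂ CyclicEdge (cong fold p₀+s≡p) (cong fold q₀+s≡q)
      (cyclicEdge-rotate s inv p₀<m q₀<m (fold-range (subst (_< m + m) (sym p₀+s≡p) (≤-<-trans p≤ a+m<2m)))
                               (fold-range (subst (_< m + m) (sym q₀+s≡q) (≤-<-trans q≤ a+m<2m)))
         (rotatesBy-fold s p₀ (subst (_< m + m) (sym p₀+s≡p) (≤-<-trans p≤ a+m<2m)))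
         (rotatesBy-fold s q₀ (subst (_< m + m) (sym q₀+s≡q) (≤-<-trans q≤ a+m<2m)))
         (edge⇒cyclic q₀<m (t⊆edges c₀)))
    where
    s≤p : s ≤ p
    s≤p = ≤-trans (m≤n+m s a) (proj₁ (chord-bounds c))
    s≤q : s ≤ q
    s≤q = ≤-trans s≤p (<⇒≤ (proj₁ (proj₂ (chord-bounds c))))
    p₀ = p ∸ s
    q₀ = q ∸ s
    p₀+s≡p : p₀ + s ≡ p
    p₀+s≡p = m∸n+n≡m s≤p
    q₀+s≡q : q₀ + s ≡ q
    q₀+s≡q = m∸n+n≡m s≤q
    c₀ : Chord t a p₀ q₀
    c₀ = chord-unshift t a s (subst (λ z → Chord t z (s + p₀) (s + q₀)) (+-comm a s)
           (subst₂ (Chord t (a + s)) (trans (sym p₀+s≡p) (+-comm p₀ s)) (trans (sym q₀+s≡q) (+-comm q₀ s)) c))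
    q₀<m : q₀ < m
    q₀<m = ≤-<-trans (proj₂ (proj₂ (first-copy-bounds c₀))) a+n<m
    p₀<m : p₀ < m
    p₀<m = <-trans (proj₁ (proj₂ (first-copy-bounds c₀))) q₀<m

  invariant-copy : ∀ r → r < 3 → Invariant m (r * n) M
  invariant-copy 0 _ i j i' j' i<m j<m i'<m j'<m ri rj =
    subst₂ (λ x y → HasSegment M i j ⇔ HasSegment M x y) (fixed i<m ri) (fixed j<m rj) (mk⇔ (λ h → h) (λ h → h))
    where
    fixed : ∀ {u u'} → u < m → RotatesBy m 0 u u' → u ≡ u'
    fixed {u} _ (inj₁ u+0≡u') = trans (sym (+-identityʳ u)) u+0≡u'
    fixed {u} {u'} u<m (inj₂ u+0≡u'+m) =
      ⊥-elim (<⇒≱ (subst (_< m) (sym (+-identityʳ u)) u<m) (subst (m ≤_) (sym u+0≡u'+m) (m≤n+m m u')))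
  invariant-copy 1 _ = subst (λ s → Invariant m s M) (sym (+-identityʳ n)) invariant-n
  invariant-copy 2 _ = invariant-2n
  invariant-copy (suc (suc (suc _))) (s≤s (s≤s (s≤s ())))

  copy-cyclic : ∀ r → r < 3 → ∀ {p q} → Chord t (offset r) p q → CyclicEdge (fold p) (fold q)
  copy-cyclic r r<3 c = copy-by (r * n) (invariant-copy r r<3) c (proj₁ (copy-bounds r r<3 c)) (proj₂ (copy-bounds r r<3 c))

  folded⊆M : ∀ {i j} → Folded i j → M i j
  folded⊆M {i} {j} f with folded⇒copy f
  ... | r , r<3 , p , q , c , _ , o = cyclic⇒M (proj₁ f) (unfold-pair o (copy-cyclic r r<3 c))
    where
    unfold-pair : FoldsTo p q i j → CyclicEdge (fold p) (fold q) → CyclicEdge i j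
    unfold-pair (inj₁ (refl , refl)) e = e
    unfold-pair (inj₂ (refl , refl)) e = cyclicEdge-sym e

  -- the converse inclusion follows by maximality of the folded triangulation
  M⊆folded : ∀ {i j} → M i j → Folded i j
  M⊆folded {i} {j} mij with folded? i j
  ... | yes f = f
  ... | no ¬f with folded-maximal i j (diagonal mij) ¬f
  ...   | k , l , fkl , cr = ⊥-elim (noncrossing mij (folded⊆M fkl) cr)

  M⇔folded : ∀ i j → M i j ⇔ Folded i j
  M⇔folded i j = mk⇔ M⊆folded folded⊆M

module Injectivity (n : ℕ) (n≥1 : 1 ≤ n) (t t' : Tree) (width-t : width t ≡ n) (width-t' : width t' ≡ n) where
  module C (a : ℕ) (a<n : a < n) = Construction n n≥1 t width-t a a<n
  module C' (a : ℕ) (a<n : a < n) = Construction n n≥1 t' width-t' a a<n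
  module F (a : ℕ) (a<n : a < n) = FirstCopy n n≥1 t width-t a a<n
  module F' (a : ℕ) (a<n : a < n) = FirstCopy n n≥1 t' width-t' a a<n

  Same : ∀ a a' → a < n → a' < n → Set
  Same a a' a<n a'<n = ∀ i j → C.Folded a a<n i j ⇔ C'.Folded a' a'<n i j

  roots-cross : ∀ {a a'} → a < a' → a' < n → Crosses a (a + n) a' (a' + n)
  roots-cross {a} {a'} a<a' a'<n = inj₁ (a<a' , <-≤-trans a'<n (m≤n+m n a) , +-monoˡ-< n a<a')

  same-vertex : ∀ a a' (a<n : a < n) (a'<n : a' < n) → Same a a' a<n a'<n → a ≡ a'
  same-vertex a a' a<n a'<n same with n ≟ 1
  ... | yes refl = trans (n<1⇒n≡0 a<n) (sym (n<1⇒n≡0 a'<n))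
  ... | no n≢1 with <-cmp a a'
  ...   | tri≈ _ a≡a' _ = a≡a'
  ...   | tri< a<a' _ _ = ⊥-elim (C.folded-noncrossing a a<n (F.folded-root a a<n n≥2)
                                    (from (same a' (a' + n)) (F'.folded-root a' a'<n n≥2)) (roots-cross a<a' a'<n))
    where n≥2 = ≤∧≢⇒< n≥1 (≢-sym n≢1)
  ...   | tri> _ _ a'<a = ⊥-elim (C'.folded-noncrossing a' a'<n (F'.folded-root a' a'<n n≥2)
                                    (to (same a (a + n)) (F.folded-root a a<n n≥2)) (roots-cross a'<a a<n))
    where n≥2 = ≤∧≢⇒< n≥1 (≢-sym n≢1)

  -- With the same vertex a, each chord of t at a is a chord of t' at a: otherwise it
  -- crosses one, and both are edges of the same triangulation.
  same-tree : ∀ a (a<n a<n' : a < n) → Same a a a<n a<n' → t ≡ t'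
  same-tree a a<n a<n' same = chords-⊆-injective t t' a (trans width-t (sym width-t')) t⊆t'
    where
    open F a a<n using (first-copy-edge; first-copy-bounds)
    open C a a<n using (folded-triangulation; a+n<m)
    open TriangulationProperties folded-triangulation using (edges-noncrossing)
    transfer : ∀ {x y} → Edge (3 * n) (C'.Folded a a<n') x y → Edge (3 * n) (C.Folded a a<n) x y
    transfer (inj₁ e) = inj₁ e
    transfer (inj₂ (inj₁ e)) = inj₂ (inj₁ e)
    transfer (inj₂ (inj₂ f)) = inj₂ (inj₂ (from (same _ _) f))
    t⊆t' : Chord t a ⊆ᶜ Chord t' a
    t⊆t' {i} {j} c with chord? t' a i j
    ... | yes c' = c'
    ... | no ¬c' with first-copy-bounds c
    ...   | a≤i , i<j , j≤a+n with chords-maximal t' a i j a≤i i<j (subst (λ w → j ≤ a + w) (sym width-t') j≤a+n) ¬c'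
    ...     | k , l , c' , cr = ⊥-elim (edges-noncrossing (≤-<-trans j≤a+n a+n<m) (≤-<-trans l≤a+n a+n<m)
                                         (first-copy-edge c) (transfer (F'.first-copy-edge a a<n' c')) cr)
      where l≤a+n = proj₂ (proj₂ (F'.first-copy-bounds a a<n' c'))

  construction-injective : ∀ a a' (a<n : a < n) (a'<n : a' < n) → Same a a' a<n a'<n → a ≡ a' × t ≡ t'
  construction-injective a a' a<n a'<n same with same-vertex a a' a<n a'<n same
  ... | refl = refl , same-tree a a<n a'<n same

diagSet-ext : ∀ {m} (D D' : DiagSet m) → (∀ i j → D ∋⟨ i , j ⟩ ⇔ D' ∋⟨ i , j ⟩) → D ≡ D'
diagSet-ext D D' same = begin
  D                     ≡⟨ tabulate∘lookup D ⟨
  tabulate (lookup D)   ≡⟨ tabulate-cong (λ i → ⊆-antisym (to (same i _)) (from (same i _))) ⟩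
  tabulate (lookup D')  ≡⟨ tabulate∘lookup D' ⟩
  D'                    ∎
  where open ≡-Reasoning

module FromRelation (m : ℕ) (R : ℕ → ℕ → Set) (R? : ∀ i j → Dec (R i j)) where

  diagSet : DiagSet m
  diagSet = tabulate λ i → tabulate λ j → does (R? (toℕ i) (toℕ j))

  diagSet-∋ : ∀ i j → diagSet ∋⟨ i , j ⟩ ⇔ R (toℕ i) (toℕ j)
  diagSet-∋ i j = mk⇔ member⇒R R⇒member
    where
    entry : lookup (lookup diagSet i) j ≡ does (R? (toℕ i) (toℕ j))
    entry = trans (cong (λ row → lookup row j) (lookup∘tabulate _ i)) (lookup∘tabulate _ j)
    member⇒R : diagSet ∋⟨ i , j ⟩ → R (toℕ i) (toℕ j)
    member⇒R h with R? (toℕ i) (toℕ j) | trans (sym entry) ([]=⇒lookup h)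
    ... | yes r | _ = r
    ... | no _ | ()
    R⇒member : R (toℕ i) (toℕ j) → diagSet ∋⟨ i , j ⟩
    R⇒member r = lookup⇒[]= j (lookup diagSet i) (trans entry (holds (R? (toℕ i) (toℕ j))))
      where
      holds : (d : Dec (R (toℕ i) (toℕ j))) → does d ≡ true
      holds (yes _) = refl
      holds (no ¬r) = ⊥-elim (¬r r)

  diagSet-Has : ∀ i j → Has diagSet i j ⇔ HasSegment R (toℕ i) (toℕ j)
  diagSet-Has i j = mk⇔ (λ { (inj₁ h) → inj₁ (to (diagSet-∋ i j) h) ; (inj₂ h) → inj₂ (to (diagSet-∋ j i) h) })
                        (λ { (inj₁ h) → inj₁ (from (diagSet-∋ i j) h) ; (inj₂ h) → inj₂ (from (diagSet-∋ j i) h) })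

  diagSet-triangulation : Triangulation m R → IsTriangulation m diagSet
  diagSet-triangulation T = diagonals , noncrossing' , maximal'
    where
    open Triangulation T
    diagonals : ∀ i j → diagSet ∋⟨ i , j ⟩ → IsDiagonal m i j
    diagonals i j h with diagonal (to (diagSet-∋ i j) h)
    ... | i+1<j , _ , not-side = i+1<j , not-side
    noncrossing' : ∀ i j k l → diagSet ∋⟨ i , j ⟩ → diagSet ∋⟨ k , l ⟩ → ¬ Cross i j k l
    noncrossing' i j k l h h' = noncrossing (to (diagSet-∋ i j) h) (to (diagSet-∋ k l) h')
    maximal' : ∀ i j → IsDiagonal m i j → ¬ (diagSet ∋⟨ i , j ⟩) → ∃[ k ] ∃[ l ] (diagSet ∋⟨ k , l ⟩ × Cross i j k l)
    maximal' i j (i+1<j , not-side) ¬h with maximal (toℕ i) (toℕ j) (i+1<j , toℕ<n j , not-side) (λ r → ¬h (from (diagSet-∋ i j) r))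
    ... | k , l , rkl , cr = fromℕ< k<m , fromℕ< l<m ,
            from (diagSet-∋ (fromℕ< k<m) (fromℕ< l<m)) (subst₂ R (sym (toℕ-fromℕ< k<m)) (sym (toℕ-fromℕ< l<m)) rkl) ,
            subst₂ (Crosses (toℕ i) (toℕ j)) (sym (toℕ-fromℕ< k<m)) (sym (toℕ-fromℕ< l<m)) cr
      where
      l<m = proj₁ (proj₂ (diagonal rkl))
      k<m = <-trans (diag-ordered (diagonal rkl)) l<m

  diagSet-invariant : ∀ s → Invariant m s R → InvariantUnderRotation m s diagSet
  diagSet-invariant s inv i j i' j' ri rj =
    ⇔-sym (diagSet-Has i' j') ⇔-∘ (inv _ _ _ _ (toℕ<n i) (toℕ<n j) (toℕ<n i') (toℕ<n j') ri rj ⇔-∘ diagSet-Has i j)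

module ToRelation (m : ℕ) (D : DiagSet m) where

  Rel : ℕ → ℕ → Set
  Rel i j = ∃₂ λ (fi fj : Fin m) → toℕ fi ≡ i × toℕ fj ≡ j × D ∋⟨ fi , fj ⟩

  Rel-∋ : ∀ fi fj → Rel (toℕ fi) (toℕ fj) ⇔ D ∋⟨ fi , fj ⟩
  Rel-∋ fi fj = mk⇔ (λ { (gi , gj , e , e' , h) → subst₂ (λ x y → D ∋⟨ x , y ⟩) (toℕ-injective e) (toℕ-injective e') h })
                    (λ h → fi , fj , refl , refl , h)

  Rel? : ∀ i j → Dec (Rel i j)
  Rel? i j with i <? m | j <? m
  ... | no i≮m | _ = no λ { (fi , _ , refl , _ , _) → i≮m (toℕ<n fi) }
  ... | yes _ | no j≮m = no λ { (_ , fj , _ , refl , _) → j≮m (toℕ<n fj) }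
  ... | yes i<m | yes j<m with fromℕ< j<m ∈? lookup D (fromℕ< i<m)
  ...   | yes h = yes (fromℕ< i<m , fromℕ< j<m , toℕ-fromℕ< i<m , toℕ-fromℕ< j<m , h)
  ...   | no ¬h = no λ { (fi , fj , refl , refl , h) →
                    ¬h (subst₂ (λ x y → D ∋⟨ x , y ⟩) (sym (fromℕ<-toℕ fi i<m)) (sym (fromℕ<-toℕ fj j<m)) h) }

  Rel-Has : ∀ fi fj → Has D fi fj ⇔ HasSegment Rel (toℕ fi) (toℕ fj)
  Rel-Has fi fj = mk⇔ (λ { (inj₁ h) → inj₁ (from (Rel-∋ fi fj) h) ; (inj₂ h) → inj₂ (from (Rel-∋ fj fi) h) })
                      (λ { (inj₁ h) → inj₁ (to (Rel-∋ fi fj) h) ; (inj₂ h) → inj₂ (to (Rel-∋ fj fi) h) })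

  Rel-triangulation : IsTriangulation m D → Triangulation m Rel
  Rel-triangulation (diagonals , noncrossing' , maximal') =
    record { diagonal = diagonal ; noncrossing = noncrossing ; maximal = maximal ; decide = Rel? }
    where
    diagonal : ∀ {i j} → Rel i j → IsDiag m i j
    diagonal (fi , fj , refl , refl , h) with diagonals fi fj h
    ... | i+1<j , not-side = i+1<j , toℕ<n fj , not-side
    noncrossing : ∀ {i j k l} → Rel i j → Rel k l → ¬ Crosses i j k l
    noncrossing (fi , fj , refl , refl , h) (fk , fl , refl , refl , h') = noncrossing' fi fj fk fl h h'
    maximal : ∀ i j → IsDiag m i j → ¬ Rel i j → ∃₂ λ k l → Rel k l × Crosses i j k l
    maximal i j (i+1<j , j<m , not-side) ¬r
      with maximal' fi fj (subst₂ (λ x y → suc x < y) (sym ei) (sym ej) i+1<j , subst₂ (λ x y → 0 < x ⊎ suc y < m) (sym ei) (sym ej) not-side)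
                    (λ h → ¬r (fi , fj , ei , ej , h))
      where
      i<m = <-trans (<-trans (n<1+n i) i+1<j) j<m
      fi = fromℕ< i<m
      fj = fromℕ< j<m
      ei = toℕ-fromℕ< i<m
      ej = toℕ-fromℕ< j<m
    ... | fk , fl , h , cr = toℕ fk , toℕ fl , (fk , fl , refl , refl , h) ,
                             subst₂ (λ x y → Crosses x y (toℕ fk) (toℕ fl)) (toℕ-fromℕ< _) (toℕ-fromℕ< j<m) cr

  Rel-invariant : ∀ s → InvariantUnderRotation m s D → Invariant m s Rel
  Rel-invariant s inv i j i' j' i<m j<m i'<m j'<m ri rj =
    relabel i' j' i'<m j'<m ⇔-∘ (Rel-Has _ _ ⇔-∘ (inv _ _ _ _ (rotates i<m i'<m ri) (rotates j<m j'<m rj) ⇔-∘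
      (⇔-sym (Rel-Has _ _) ⇔-∘ ⇔-sym (relabel i j i<m j<m))))
    where
    relabel : ∀ x y (x<m : x < m) (y<m : y < m) → HasSegment Rel (toℕ (fromℕ< x<m)) (toℕ (fromℕ< y<m)) ⇔ HasSegment Rel x y
    relabel x y x<m y<m = subst₂ (λ u v → HasSegment Rel (toℕ (fromℕ< x<m)) (toℕ (fromℕ< y<m)) ⇔ HasSegment Rel u v)
                                 (toℕ-fromℕ< x<m) (toℕ-fromℕ< y<m) (mk⇔ (λ h → h) (λ h → h))
    rotates : ∀ {x y} (x<m : x < m) (y<m : y < m) → RotatesBy m s x y → RotatesTo m s (fromℕ< x<m) (fromℕ< y<m)
    rotates x<m y<m r = subst₂ (RotatesBy m s) (sym (toℕ-fromℕ< x<m)) (sym (toℕ-fromℕ< y<m)) r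

  diagSet-of-Rel : (R : ℕ → ℕ → Set) (R? : ∀ i j → Dec (R i j)) → (∀ i j → Rel i j ⇔ R i j) →
                   D ≡ FromRelation.diagSet m R R?
  diagSet-of-Rel R R? same = diagSet-ext D _ λ i j →
    ⇔-sym (FromRelation.diagSet-∋ m R R? i j) ⇔-∘ (same _ _ ⇔-∘ ⇔-sym (Rel-∋ i j))

map-unique : ∀ {A B : Set} (f : A → B) (xs : List A) → Unique xs →
             (∀ {x y} → x ∈ xs → y ∈ xs → f x ≡ f y → x ≡ y) → Unique (map f xs)
map-unique f [] _ _ = []
map-unique f (x ∷ xs) (x∉xs ∷ unique) injective =
  All.tabulate fx∉ ∷ map-unique f xs unique (λ x∈ y∈ → injective (there x∈) (there y∈))
  where
  fx∉ : ∀ {z} → z ∈ map f xs → ¬ (f x ≡ z)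
  fx∉ z∈ fx≡z with ∈-map⁻ f z∈
  ... | y , y∈ , refl = All.lookup x∉xs y∈ (injective (here refl) (there y∈) fx≡z)

length-cartesianProduct : ∀ {A B : Set} (xs : List A) (ys : List B) →
                          length (cartesianProduct xs ys) ≡ length xs * length ys
length-cartesianProduct [] ys = refl
length-cartesianProduct (x ∷ xs) ys =
  trans (length-++ (map (x ,_) ys)) (cong₂ _+_ (length-map (x ,_) ys) (length-cartesianProduct xs ys))

module Enumeration (n : ℕ) (n≥1 : 1 ≤ n) where

  m : ℕ
  m = 3 * n

  module Con (t : Tree) (width-t : width t ≡ n) (a : ℕ) (a<n : a < n) = Construction n n≥1 t width-t a a<n

  diagSetOf : ∀ t (width-t : width t ≡ n) a (a<n : a < n) → DiagSet m
  diagSetOf t width-t a a<n = FromRelation.diagSet m (Con.Folded t width-t a a<n) (Con.folded? t width-t a a<n)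

  -- the construction, extended arbitrarily outside a < n , width t ≡ n
  triangulationOf : ℕ × Tree → DiagSet m
  triangulationOf (a , t) with a <? n | width t ≟ n
  ... | yes a<n | yes width-t = diagSetOf t width-t a a<n
  ... | _ | _ = FromRelation.diagSet m (λ _ _ → ⊥) (λ _ _ → no (λ ()))

  triangulationOf≡ : ∀ a t (a<n : a < n) (width-t : width t ≡ n) → triangulationOf (a , t) ≡ diagSetOf t width-t a a<n
  triangulationOf≡ a t a<n width-t with a <? n | width t ≟ n
  ... | yes a<n' | yes width-t' rewrite <-irrelevant a<n a<n' | ≡-irrelevant width-t width-t' = refl
  ... | no a≮n | _ = ⊥-elim (a≮n a<n)
  ... | yes _ | no width≢n = ⊥-elim (width≢n width-t)

  parameters : List (ℕ × Tree)
  parameters = cartesianProduct (upTo n) (trees (n ∸ 1))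

  triangulations : List (DiagSet m)
  triangulations = map triangulationOf parameters

  width-of-member : ∀ {t} → t ∈ trees (n ∸ 1) → width t ≡ n
  width-of-member {t} t∈ = trans (width≡1+size t) (trans (cong suc (to (trees-mem (n ∸ 1) t) t∈)) (m+[n∸m]≡n n≥1))

  parameters-valid : ∀ {a t} → (a , t) ∈ parameters → a < n × width t ≡ n
  parameters-valid a,t∈ with ∈-cartesianProduct⁻ (upTo n) (trees (n ∸ 1)) a,t∈
  ... | a∈ , t∈ = ∈-upTo⁻ a∈ , width-of-member t∈

  construction-symmetric : ∀ t width-t a a<n → IsZ3SymmetricTriangulation n (diagSetOf t width-t a a<n)
  construction-symmetric t width-t a a<n =
    diagSet-triangulation folded-triangulation , diagSet-invariant n folded-invariant-n , diagSet-invariant (2 * n) folded-invariant-2n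
    where
    open Con t width-t a a<n using (Folded; folded?; folded-triangulation)
    open Symmetry n n≥1 t width-t a a<n using (folded-invariant-n; folded-invariant-2n)
    open FromRelation m Folded folded?

  sound : ∀ D → D ∈ triangulations → IsZ3SymmetricTriangulation n D
  sound D D∈ with ∈-map⁻ triangulationOf D∈
  ... | (a , t) , a,t∈ , refl with parameters-valid a,t∈
  ...   | a<n , width-t = subst (IsZ3SymmetricTriangulation n) (sym (triangulationOf≡ a t a<n width-t))
                                (construction-symmetric t width-t a a<n)

  complete : ∀ D → IsZ3SymmetricTriangulation n D → D ∈ triangulations
  complete D (triangulation , invariant-n , invariant-2n) =
    subst (_∈ triangulations) (sym D≡) (∈-map⁺ triangulationOf (∈-cartesianProduct⁺ (∈-upTo⁺ a<n) t∈))
    where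
    open ToRelation m D
    open Completeness n n≥1 (Rel-triangulation triangulation) (Rel-invariant n invariant-n) (Rel-invariant (2 * n) invariant-2n)
      using (a; a<n; t; width-t; M⇔folded)
    t∈ : t ∈ trees (n ∸ 1)
    t∈ = from (trees-mem (n ∸ 1) t) (cong (_∸ 1) (trans (sym (width≡1+size t)) width-t))
    D≡ : D ≡ triangulationOf (a , t)
    D≡ = trans (diagSet-of-Rel _ (Con.folded? t width-t a a<n) M⇔folded) (sym (triangulationOf≡ a t a<n width-t))

  same-folded : ∀ t width-t a a<n t' width-t' a' a'<n → diagSetOf t width-t a a<n ≡ diagSetOf t' width-t' a' a'<n →
                ∀ i j → Con.Folded t width-t a a<n i j → Con.Folded t' width-t' a' a'<n i j
  same-folded t width-t a a<n t' width-t' a' a'<n D≡D' i j f =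
    subst₂ (Con.Folded t' width-t' a' a'<n) (toℕ-fromℕ< i<m) (toℕ-fromℕ< j<m)
      (to (FromRelation.diagSet-∋ m _ (Con.folded? t' width-t' a' a'<n) (fromℕ< i<m) (fromℕ< j<m))
        (subst (λ D → D ∋⟨ fromℕ< i<m , fromℕ< j<m ⟩) D≡D'
          (from (FromRelation.diagSet-∋ m _ (Con.folded? t width-t a a<n) (fromℕ< i<m) (fromℕ< j<m))
            (subst₂ (Con.Folded t width-t a a<n) (sym (toℕ-fromℕ< i<m)) (sym (toℕ-fromℕ< j<m)) f))))
    where
    j<m = proj₁ (proj₂ (proj₁ f))
    i<m = <-trans (diag-ordered (proj₁ f)) j<m

  injective : ∀ {x y} → x ∈ parameters → y ∈ parameters → triangulationOf x ≡ triangulationOf y → x ≡ y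
  injective {a , t} {a' , t'} x∈ y∈ e with parameters-valid x∈ | parameters-valid y∈
  ... | a<n , width-t | a'<n , width-t' with construction-injective a a' a<n a'<n
        (λ i j → mk⇔ (same-folded t width-t a a<n t' width-t' a' a'<n D≡D' i j) (same-folded t' width-t' a' a'<n t width-t a a<n (sym D≡D') i j))
    where
    open Injectivity n n≥1 t t' width-t width-t'
    D≡D' = trans (sym (triangulationOf≡ a t a<n width-t)) (trans e (triangulationOf≡ a' t' a'<n width-t'))
  ...   | refl , refl = refl

  unique : Unique triangulations
  unique = map-unique triangulationOf parameters (cartesianProduct⁺ (upTo⁺ n) (trees-unique (n ∸ 1))) injective

  count : length triangulations ≡ n * catalan (n ∸ 1)
  count = begin
    length (map triangulationOf parameters)               ≡⟨ length-map triangulationOf parameters ⟩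
    length (cartesianProduct (upTo n) (trees (n ∸ 1)))    ≡⟨ length-cartesianProduct (upTo n) (trees (n ∸ 1)) ⟩
    length (upTo n) * treeCount (n ∸ 1)                   ≡⟨ cong₂ _*_ (length-upTo n) (sym (catalan≡treeCount (n ∸ 1))) ⟩
    n * catalan (n ∸ 1)                                   ∎
    where open ≡-Reasoning

corollary2p2 : (n : ℕ) → 1 ≤ n →
    HasCardinality (IsZ3SymmetricTriangulation n) (n * catalan (n ∸ 1))
corollary2p2 n n≥1 = triangulations , unique , (λ D → mk⇔ (sound D) (complete D)) , count
  where open Enumeration n n≥1
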